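{- Let $G=(V,E)$ be a finite loopless multigraph whose edges operate independently with probabilities $p(e)\in[0,1]$, let $K\subseteq V$ with $|K|\ge2$, and let $(G^1,G^2,X)$ be a $K$-splitting of $(G,K)$. Then \[ R(G,K)=\mathbf{p}(G^1)^T\,\mathbf{M}\,\mathbf{p}(G^2). \]
   Context: Labelled set partitions: for a finite set $Y$ and a symbol $l\notin Y$, a labelled set partition of $Y$ is $\pi=\{B_1\cup L_1,\dots,B_k\cup L_k\}$ with $\{B_1,\dots,B_k\}$ a set partition of $Y$ and $L_i\in\{\emptyset,\{l\}\}$ (labelled block iff $L_i=\{l\}$). $\Pi_l(Y)$ is the set of these, ordered by $\sigma\le\pi$ iff every block of $\sigma$ (including $l$ if present) is contained in a block of $\pi$; it is a lattice with join $\vee$. $m(\pi)=1$ if $\pi$ has exactly one labelled block, else $0$. For $\pi\in\Pi_l(W)$ and $Y\subseteq W$, $\pi\sqcap Y\in\Pi_l(Y)$ has blocks $(B\cap Y)\cup L$ for the blocks $B\cup L$ of $\pi$ with $B\cap Y\ne\emptyset$. Graphs may have parallel edges but no loops. A spanning subgraph of a graph $H=(W,F)$ is $(W,F')$, $F'\subseteq F$, with probability $\mathrm{Pr}(H')=\prod_{e\in F'}p(e)\prod_{e\in F\setminus F'}(1-p(e))$. For $K'\subseteq W$: $M(H,K')=1$ if all of $K'$ lies in one connected component, else $0$; $R(H,K')=\sum_{H'}M(H',K')\mathrm{Pr}(H')$ over spanning subgraphs $H'$ of $H$; $\{(H,K')\}\in\Pi_l(W)$ has as blocks the vertex sets of connected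 components of $H$, labelled iff meeting $K'$. For $Y\subseteq W$, $H_Y$ identifies all of $Y$ into one vertex $Y$, deleting edges with both endpoints in $Y$ and keeping other edges. $K$-splitting: $G^i=(V^i,E^i)$ subgraphs of $G$ with $E^1\cup E^2=E$, $E^1\cap E^2=\emptyset$, $V^1\cup V^2=V$, $V^1\cap V^2=X$, $K^i:=K\cap V^i\ne\emptyset$. $K^i_X=(K^i\setminus X)\cup\{X\}$. For a spanning subgraph $H^i$ of $G^i$, $D(H^i,\pi)=1$ if $\{(H^i,K^i)\}\sqcap X=\pi$, else $0$. Partition probability: $P(G^i,\pi)=\sum_{H^i}D(H^i,\pi)M(H^i_X,K^i_X)\mathrm{Pr}(H^i)$ over spanning subgraphs $H^i$ of $G^i$. $\pi_X\in\Pi_l(X)$ is the partition into singletons $\{x\}$, labelled iff $x\in K$; $\Pi_l(X,\pi_X)=\{\pi\in\Pi_l(X):\pi\ge\pi_X,\ \pi\text{ has a labelled block}\}$. With a fixed ordering of $\Pi_l(X,\pi_X)$: $\mathbf{p}(G^i)=(P(G^i,\pi))_{\pi}$ and $\mathbf{M}=(m(\pi\vee\sigma))_{\pi,\sigma\in\Pi_l(X,\pi_X)}$. -}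

module Defs where

open import Data.Nat using (ℕ; zero; suc)
open import Data.Fin using (Fin; zero; suc)
import Data.Fin as F
open import Data.Fin.Subset using (Subset; Nonempty; _∩_)
open import Data.Bool using (Bool; true; false; _∧_; _∨_; not; if_then_else_)
open import Data.Vec using (Vec; []; _∷_; lookup; tabulate)
open import Data.List using (List; []; _∷_; map; foldr; concatMap; filterᵇ; cartesianProduct)
import Data.List as L
open import Data.Bool.ListAction using (all; any)
open import Data.Product using (_×_; _,_; proj₁; proj₂)
open import Relation.Nullary.Decidable using (⌊_⌋)
open import Relation.Binary.PropositionalEquality using (_≡_)
open import Algebra.Bundles using (CommutativeRing)

_⇒ᵇ_ : Bool → Bool → Bool
a ⇒ᵇ b = not a ∨ b

_⇔ᵇ_ : Bool → Bool → Bool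
a ⇔ᵇ b = (a ∧ b) ∨ (not a ∧ not b)

allF : ∀ {n} → (Fin n → Bool) → Bool
allF {n} P = all P (L.allFin n)

anyF : ∀ {n} → (Fin n → Bool) → Bool
anyF {n} P = any P (L.allFin n)

_==_ : ∀ {n} → Fin n → Fin n → Bool
x == y = ⌊ x F.≟ y ⌋

_∈ᵇ_ : ∀ {n} → Fin n → Subset n → Bool
x ∈ᵇ S = lookup S x

_⊆ᵇ_ : ∀ {n} → Subset n → Subset n → Bool
A ⊆ᵇ B = allF λ x → (x ∈ᵇ A) ⇒ᵇ (x ∈ᵇ B)

iterate : ∀ {a} {A : Set a} → ℕ → (A → A) → A → A
iterate zero    f x = x
iterate (suc k) f x = f (iterate k f x)

allVecs : ∀ {a} {A : Set a} → List A → (k : ℕ) → List (Vec A k)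
allVecs xs zero    = [] ∷ []
allVecs xs (suc k) = concatMap (λ x → map (x ∷_) (allVecs xs k)) xs

allSubsets : (k : ℕ) → List (Subset k)
allSubsets k = allVecs (true ∷ false ∷ []) k

-- A (sub)graph is given by a set of edges F : Subset m (the
-- vertex set only matters through the sets K' considered).

Ends : ℕ → ℕ → Set
Ends N m = Fin m → Fin N × Fin N

grow : ∀ {N m} → Ends N m → Subset m → Subset N → Subset N
grow ends F S = tabulate λ v → (v ∈ᵇ S) ∨ anyF λ e →
  (e ∈ᵇ F) ∧ ( ((proj₁ (ends e) ∈ᵇ S) ∧ (proj₂ (ends e) == v))
             ∨ ((proj₂ (ends e) ∈ᵇ S) ∧ (proj₁ (ends e) == v)))

component : ∀ {N m} → Ends N m → Subset m → Fin N → Subset N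
component {N} ends F u =
  iterate N (grow ends F) (tabulate λ v → u == v)

connected : ∀ {N m} → Ends N m → Subset m → Fin N → Fin N → Bool
connected ends F u v = v ∈ᵇ component ends F u

Mᵇ : ∀ {N m} → Ends N m → Subset m → Subset N → Bool
Mᵇ ends F K' = allF λ u → allF λ v →
  ((u ∈ᵇ K') ∧ (v ∈ᵇ K')) ⇒ᵇ connected ends F u v

-- H_Y : identify all vertices of Y into the single new vertex zero;
-- a vertex v ∉ Y becomes suc v.  Edges with both ends in Y are deleted.

contractV : ∀ {N} → Subset N → Fin N → Fin (suc N)
contractV Y v = if v ∈ᵇ Y then zero else suc v

contractEnds : ∀ {N m} → Ends N m → Subset N → Ends (suc N) m
contractEnds ends Y e = contractV Y (proj₁ (ends e)) , contractV Y (proj₂ (ends e))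

contractEdges : ∀ {N m} → Ends N m → Subset N → Subset m → Subset m
contractEdges ends Y F = tabulate λ e →
  (e ∈ᵇ F) ∧ not ((proj₁ (ends e) ∈ᵇ Y) ∧ (proj₂ (ends e) ∈ᵇ Y))

-- K'_Y = (K' \ Y) ∪ {Y}
contractK : ∀ {N} → Subset N → Subset N → Subset (suc N)
contractK K' Y = true ∷ tabulate (λ v → (v ∈ᵇ K') ∧ not (v ∈ᵇ Y))

-- Labelled set partitions of a subset X ⊆ Fin n, in canonical form:
-- rel x y = "x and y lie in the same block" (only for x,y ∈ X),
-- lab x  = "the block of x is labelled" (only for x ∈ X).

record LPart (n : ℕ) : Set where
  constructor lpart
  field
    rel : Vec (Vec Bool n) n
    lab : Subset n

open LPart public

relᵇ : ∀ {n} → LPart n → Fin n → Fin n → Bool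
relᵇ π x y = lookup (lookup (rel π) x) y

labᵇ : ∀ {n} → LPart n → Fin n → Bool
labᵇ π x = x ∈ᵇ lab π

isLPart : ∀ {n} → Subset n → LPart n → Bool
isLPart X π = allF λ x → allF λ y →
     (relᵇ π x y ⇒ᵇ ((x ∈ᵇ X) ∧ (y ∈ᵇ X)))
   ∧ ((x ∈ᵇ X) ⇒ᵇ relᵇ π x x)
   ∧ (relᵇ π x y ⇒ᵇ relᵇ π y x)
   ∧ (allF λ z → (relᵇ π x y ∧ relᵇ π y z) ⇒ᵇ relᵇ π x z)
   ∧ (labᵇ π x ⇒ᵇ (x ∈ᵇ X))
   ∧ (relᵇ π x y ⇒ᵇ (labᵇ π x ⇔ᵇ labᵇ π y))

ΠL : ∀ {n} → Subset n → List (LPart n)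
ΠL {n} X = filterᵇ (isLPart X)
  (map (λ rl → lpart (proj₁ rl) (proj₂ rl))
       (cartesianProduct (allVecs (allSubsets n) n) (allSubsets n)))

eqLPart : ∀ {n} → LPart n → LPart n → Bool
eqLPart π σ = (allF λ x → allF λ y → relᵇ π x y ⇔ᵇ relᵇ σ x y)
            ∧ (allF λ x → labᵇ π x ⇔ᵇ labᵇ σ x)

leqᵇ : ∀ {n} → LPart n → LPart n → Bool
leqᵇ σ π = (allF λ x → allF λ y → relᵇ σ x y ⇒ᵇ relᵇ π x y)
         ∧ (allF λ x → labᵇ σ x ⇒ᵇ labᵇ π x)

private
  square : ∀ {n} → (Fin n → Fin n → Bool) → (Fin n → Fin n → Bool)
  square R x y = R x y ∨ anyF λ z → R x z ∧ R z y

joinRel : ∀ {n} → LPart n → LPart n → Fin n → Fin n → Bool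
joinRel {n} π σ = iterate n square (λ x y → relᵇ π x y ∨ relᵇ σ x y)

_∨ᴸ_ : ∀ {n} → LPart n → LPart n → LPart n
π ∨ᴸ σ = lpart (tabulate λ x → tabulate λ y → joinRel π σ x y)
               (tabulate λ x → anyF λ z → joinRel π σ x z ∧ (labᵇ π z ∨ labᵇ σ z))

mᵇ : ∀ {n} → LPart n → Bool
mᵇ π = (anyF λ x → labᵇ π x)
     ∧ (allF λ x → allF λ y → (labᵇ π x ∧ labᵇ π y) ⇒ᵇ relᵇ π x y)

πX : ∀ {n} → Subset n → Subset n → LPart n
πX X K = lpart (tabulate λ x → tabulate λ y → (x ∈ᵇ X) ∧ (x == y))
               (tabulate λ x → (x ∈ᵇ X) ∧ (x ∈ᵇ K))

ΠLX : ∀ {n} → Subset n → Subset n → List (LPart n)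
ΠLX X K = filterᵇ (λ π → leqᵇ (πX X K) π ∧ (anyF λ x → labᵇ π x)) (ΠL X)

compPart : ∀ {n m} → Ends n m → Subset m → Subset n → Subset n → LPart n
compPart ends F K' X =
  lpart (tabulate λ x → tabulate λ y → (x ∈ᵇ X) ∧ (y ∈ᵇ X) ∧ connected ends F x y)
        (tabulate λ x → (x ∈ᵇ X) ∧ anyF λ k → (k ∈ᵇ K') ∧ connected ends F x k)

record KSplitting {n m : ℕ} (ends : Ends n m) (K : Subset n) : Set where
  field
    V¹ V² : Subset n
    E¹ E² : Subset m
    E-cover    : ∀ e → (e ∈ᵇ E¹) ∨ (e ∈ᵇ E²) ≡ true
    E-disjoint : ∀ e → (e ∈ᵇ E¹) ∧ (e ∈ᵇ E²) ≡ false
    V-cover    : ∀ v → (v ∈ᵇ V¹) ∨ (v ∈ᵇ V²) ≡ true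
    sub¹ : ∀ e → e ∈ᵇ E¹ ≡ true →
             (proj₁ (ends e) ∈ᵇ V¹ ≡ true) × (proj₂ (ends e) ∈ᵇ V¹ ≡ true)
    sub² : ∀ e → e ∈ᵇ E² ≡ true →
             (proj₁ (ends e) ∈ᵇ V² ≡ true) × (proj₂ (ends e) ∈ᵇ V² ≡ true)
    K¹-nonempty : Nonempty (K ∩ V¹)
    K²-nonempty : Nonempty (K ∩ V²)

  X : Subset n
  X = V¹ ∩ V²

  K¹ K² : Subset n
  K¹ = K ∩ V¹
  K² = K ∩ V²

module _ {c ℓ} (CR : CommutativeRing c ℓ) where
  open CommutativeRing CR using (Carrier; _+_; _*_; -_; 0#; 1#)

  Σ-list : {A : Set} → List A → (A → Carrier) → Carrier
  Σ-list xs f = foldr (λ x acc → f x + acc) 0# xs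

  Π-fin : ∀ {k} → (Fin k → Carrier) → Carrier
  Π-fin {zero}  f = 1#
  Π-fin {suc k} f = f zero * Π-fin (λ i → f (suc i))

  ind : Bool → Carrier
  ind b = if b then 1# else 0#

  Pr : ∀ {m} → (Fin m → Carrier) → Subset m → Subset m → Carrier
  Pr p F F' = Π-fin λ e →
    if e ∈ᵇ F then (if e ∈ᵇ F' then p e else 1# + (- p e)) else 1#

  Σspan : ∀ {m} → Subset m → (Subset m → Carrier) → Carrier
  Σspan {m} F f = Σ-list (allSubsets m) λ F' → ind (F' ⊆ᵇ F) * f F'

  Rel : ∀ {n m} → Ends n m → (Fin m → Carrier) → Subset m → Subset n → Carrier
  Rel ends p F K' = Σspan F λ F' → ind (Mᵇ ends F' K') * Pr p F F'

  PartProb : ∀ {n m} → Ends n m → (Fin m → Carrier) →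
             Subset m → Subset n → Subset n → LPart n → Carrier
  PartProb ends p Ei Ki X π = Σspan Ei λ F' →
      ind (eqLPart (compPart ends F' Ki X) π)
    * ind (Mᵇ (contractEnds ends X) (contractEdges ends X F') (contractK Ki X))
    * Pr p Ei F'

  -- p(G¹)ᵀ M p(G²) = Σ_{π,σ ∈ Π_l(X,π_X)} P(G¹,π) m(π ∨ σ) P(G²,σ)
  bilinear : ∀ {n m} (ends : Ends n m) → (Fin m → Carrier) →
             (K : Subset n) → KSplitting ends K → Carrier
  bilinear ends p K S =
    Σ-list (ΠLX X K) λ π → Σ-list (ΠLX X K) λ σ →
      PartProb ends p E¹ K¹ X π * ind (mᵇ (π ∨ᴸ σ)) * PartProb ends p E² K² X σ
    where open KSplitting S

module Submission where

-- Write R(G,K) = Σ_F Pr(F) M(F,K) over the spanning subgraphs F of G.  As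
-- E = E¹ ⊔ E² and the edges are independent, this is a double sum over pairs
-- F₁ ⊆ E¹, F₂ ⊆ E² of Pr(F₁) Pr(F₂) M(F₁ ∪ F₂, K) (module Factorisation).
-- The combinatorial heart (Splitting.M-splits) is that for such a pair
--   M(F₁ ∪ F₂, K) = M(H¹_X, K¹_X) · M(H²_X, K²_X) · m(π₁ ∨ π₂),
-- where πᵢ = {(Hⁱ, Kⁱ)} ⊓ X: a walk from one side to the other passes
-- through X, and connectivity in F₁ ∪ F₂ between vertices of X is exactly
-- the join of the two block structures.  When M(Hⁱ_X, Kⁱ_X) holds, πᵢ is one
-- of the enumerated partitions Π_l(X, π_X), so in the bilinear form only the
-- term (π, σ) = (π₁, π₂) survives; exchanging the order of summation ends.

open import Defs

open import Data.Nat using (ℕ; zero; suc; _≤_; _<_; z≤n; s≤s)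
import Data.Nat as ℕ
import Data.Nat.Properties as ℕP
open import Data.Fin as Fin using (Fin; zero; suc; punchOut)
open import Data.Fin.Properties using (punchOut-injective)
open import Data.Fin.Subset using (Subset; ⊤; ∣_∣; _∩_; _∪_)
open import Function using (_∘_)
open import Data.Bool using (Bool; true; false; _∧_; _∨_; not; T; if_then_else_)
open import Data.Bool.Properties using (T?)
open import Data.Unit using (tt)
open import Data.Empty using (⊥-elim)
open import Data.Product using (Σ; ∃; _×_; _,_; proj₁; proj₂)
open import Data.Sum using (_⊎_; inj₁; inj₂)
open import Data.List as List using (List; []; _∷_; length)
open import Data.List.Relation.Unary.All as All using (All; []; _∷_)
import Data.List.Relation.Unary.All.Properties as AllP
import Data.List.Relation.Unary.Any.Properties as AnyP
open import Data.List.Relation.Unary.Any using (here; there)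
open import Data.List.Relation.Unary.AllPairs using ([]; _∷_)
open import Data.List.Relation.Unary.Unique.Propositional using (Unique)
import Data.List.Relation.Unary.Unique.Propositional.Properties as UniqueP
open import Data.List.Relation.Binary.Disjoint.Propositional using (Disjoint)
open import Data.List.Membership.Propositional using (_∈_)
import Data.List.Membership.DecPropositional as DecMembership
open import Data.List.Membership.Propositional.Properties
  using (∈-map⁺; ∈-map⁻; ∈-filter⁺; ∈-cartesianProduct⁺; ∈-++⁺ˡ; ∈-++⁺ʳ; ∈-++⁻)
open import Data.Vec as Vec using (Vec; lookup; tabulate; []; _∷_)
open import Data.Vec.Properties
  using (lookup∘tabulate; lookup-zipWith; []=⇒lookup; tabulate∘lookup; tabulate-cong; ∷-injectiveʳ)
open import Algebra.Bundles using (CommutativeRing)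
import Relation.Binary.Reasoning.Setoid as ≈-Reasoning
import Algebra.Solver.CommutativeMonoid as CMSolver
open import Relation.Nullary using (¬_; yes; no)
open import Relation.Nullary.Decidable using (toWitness; fromWitness)
open import Relation.Binary.PropositionalEquality
  using (_≡_; _≢_; refl; sym; trans; cong; cong₂; subst; subst₂)

-- T is not injective, so the left operand of a binary
-- connective must often be supplied explicitly at use sites.

∧-intro : ∀ {a b} → T a → T b → T (a ∧ b)
∧-intro {true} _ b = b

∧-fst : ∀ {a b} → T (a ∧ b) → T a
∧-fst {true} _ = tt

∧-snd : ∀ {a b} → T (a ∧ b) → T b
∧-snd {true} b = b

∨-inl : ∀ {a b} → T a → T (a ∨ b)
∨-inl {true} _ = tt

∨-inr : ∀ {a b} → T b → T (a ∨ b)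
∨-inr {true} _ = tt
∨-inr {false} b = b

∨-elim : ∀ {a b} → T (a ∨ b) → T a ⊎ T b
∨-elim {true} _ = inj₁ tt
∨-elim {false} b = inj₂ b

⇒-intro : ∀ {a b} → (T a → T b) → T (a ⇒ᵇ b)
⇒-intro {true} f = f tt
⇒-intro {false} _ = tt

⇒-elim : ∀ {a b} → T (a ⇒ᵇ b) → T a → T b
⇒-elim {true} {true} _ _ = tt

⇔-intro : ∀ {a b} → (T a → T b) → (T b → T a) → T (a ⇔ᵇ b)
⇔-intro {true} {true} _ _ = tt
⇔-intro {true} {false} f _ = f tt
⇔-intro {false} {true} _ g = g tt
⇔-intro {false} {false} _ _ = tt

⇔-refl : ∀ a → T (a ⇔ᵇ a)
⇔-refl true = tt
⇔-refl false = tt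

⇔-to-≡ : ∀ {a b} → T (a ⇔ᵇ b) → a ≡ b
⇔-to-≡ {true} {true} _ = refl
⇔-to-≡ {false} {false} _ = refl

not-intro : ∀ {a} → ¬ T a → T (not a)
not-intro {true} f = f tt
not-intro {false} _ = tt

not-elim : ∀ {a} → T (not a) → ¬ T a
not-elim {true} ()

T-to-≡ : ∀ {a} → T a → a ≡ true
T-to-≡ {true} _ = refl

≡-to-T : ∀ {a} → a ≡ true → T a
≡-to-T refl = tt

bool-ext : ∀ {a b} → (T a → T b) → (T b → T a) → a ≡ b
bool-ext {true} {true} _ _ = refl
bool-ext {true} {false} f _ = ⊥-elim (f tt)
bool-ext {false} {true} _ g = ⊥-elim (g tt)
bool-ext {false} {false} _ _ = refl

allF-intro : ∀ {n} {P : Fin n → Bool} → (∀ x → T (P x)) → T (allF P)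
allF-intro {P = P} h = AllP.all⁻ P (AllP.tabulate⁺ h)

allF-elim : ∀ {n} {P : Fin n → Bool} → T (allF P) → ∀ x → T (P x)
allF-elim {P = P} h = AllP.tabulate⁻ (AllP.all⁺ P _ h)

anyF-intro : ∀ {n} {P : Fin n → Bool} x → T (P x) → T (anyF P)
anyF-intro {P = P} x h = AnyP.any⁺ P (AnyP.tabulate⁺ x h)

anyF-elim : ∀ {n} {P : Fin n → Bool} → T (anyF P) → ∃ λ x → T (P x)
anyF-elim {P = P} h = AnyP.tabulate⁻ (AnyP.any⁻ P _ h)

==-elim : ∀ {n} {x y : Fin n} → T (x == y) → x ≡ y
==-elim = toWitness

==-intro : ∀ {n} {x y : Fin n} → x ≡ y → T (x == y)
==-intro = fromWitness

tab-elim : ∀ {n} {f : Fin n → Bool} {x} → T (lookup (tabulate f) x) → T (f x)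
tab-elim {f = f} {x} = subst T (lookup∘tabulate f x)

tab-intro : ∀ {n} {f : Fin n → Bool} {x} → T (f x) → T (lookup (tabulate f) x)
tab-intro {f = f} {x} = subst T (sym (lookup∘tabulate f x))

lookup²∘tabulate² : ∀ {n} (g : Fin n → Fin n → Bool) x y →
                    lookup (lookup (tabulate λ x → tabulate (g x)) x) y ≡ g x y
lookup²∘tabulate² g x y =
  trans (cong (λ v → lookup v y) (lookup∘tabulate (λ x → tabulate (g x)) x))
        (lookup∘tabulate (g x) y)

tab²-elim : ∀ {n} (g : Fin n → Fin n → Bool) x y →
            T (lookup (lookup (tabulate λ x → tabulate (g x)) x) y) → T (g x y)
tab²-elim g x y = subst T (lookup²∘tabulate² g x y)

tab²-intro : ∀ {n} (g : Fin n → Fin n → Bool) x y →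
             T (g x y) → T (lookup (lookup (tabulate λ x → tabulate (g x)) x) y)
tab²-intro g x y = subst T (sym (lookup²∘tabulate² g x y))

∩-elim : ∀ {n} (A B : Subset n) x → T (x ∈ᵇ (A ∩ B)) → T (x ∈ᵇ A) × T (x ∈ᵇ B)
∩-elim A B x h = let h' = subst T (lookup-zipWith _∧_ x A B) h in ∧-fst {x ∈ᵇ A} h' , ∧-snd {x ∈ᵇ A} h'

∩-intro : ∀ {n} (A B : Subset n) x → T (x ∈ᵇ A) → T (x ∈ᵇ B) → T (x ∈ᵇ (A ∩ B))
∩-intro A B x a b = subst T (sym (lookup-zipWith _∧_ x A B)) (∧-intro {x ∈ᵇ A} a b)

∪-elim : ∀ {n} (A B : Subset n) x → T (x ∈ᵇ (A ∪ B)) → T (x ∈ᵇ A) ⊎ T (x ∈ᵇ B)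
∪-elim A B x h = ∨-elim {x ∈ᵇ A} (subst T (lookup-zipWith _∨_ x A B) h)

∪-inl : ∀ {n} (A B : Subset n) x → T (x ∈ᵇ A) → T (x ∈ᵇ (A ∪ B))
∪-inl A B x a = subst T (sym (lookup-zipWith _∨_ x A B)) (∨-inl {x ∈ᵇ A} a)

∪-inr : ∀ {n} (A B : Subset n) x → T (x ∈ᵇ B) → T (x ∈ᵇ (A ∪ B))
∪-inr A B x b = subst T (sym (lookup-zipWith _∨_ x A B)) (∨-inr {x ∈ᵇ A} b)

-- Lengths are tracked because both
-- connectivity tests of Defs only explore walks of bounded length.

data Walk {A : Set} (R : A → A → Set) : A → A → ℕ → Set where
  nil  : ∀ {x} → Walk R x x 0
  cons : ∀ {x y z k} → R x y → Walk R y z k → Walk R x z (suc k)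

Reach : {A : Set} → (A → A → Set) → A → A → Set
Reach R x y = ∃ λ k → Walk R x y k

module _ {A : Set} {R : A → A → Set} where

  walk-++ : ∀ {x y z a b} → Walk R x y a → Walk R y z b → Walk R x z (a ℕ.+ b)
  walk-++ nil w = w
  walk-++ (cons r v) w = cons r (walk-++ v w)

  walk-split : ∀ a {b x y} → Walk R x y (a ℕ.+ b) → ∃ λ z → Walk R x z a × Walk R z y b
  walk-split zero w = _ , nil , w
  walk-split (suc a) (cons r w) with walk-split a w
  ... | z , w₁ , w₂ = z , cons r w₁ , w₂

  reach-refl : ∀ {x} → Reach R x x
  reach-refl = 0 , nil

  reach-step : ∀ {x y} → R x y → Reach R x y
  reach-step r = 1 , cons r nil

  reach-trans : ∀ {x y z} → Reach R x y → Reach R y z → Reach R x z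
  reach-trans (_ , v) (_ , w) = _ , walk-++ v w

  reach-sym : (∀ {x y} → R x y → R y x) → ∀ {x y} → Reach R x y → Reach R y x
  reach-sym s (_ , nil) = reach-refl
  reach-sym s (_ , cons r w) = reach-trans (reach-sym s (_ , w)) (reach-step (s r))

  reach-invariant : (P : A → Set) → (∀ {x y} → R x y → P x → P y) →
                    ∀ {x y} → Reach R x y → P x → P y
  reach-invariant P h (_ , nil) p = p
  reach-invariant P h (_ , cons r w) p = reach-invariant P h (_ , w) (h r p)

reach-map : ∀ {A B : Set} {R : A → A → Set} {S : B → B → Set} (f : A → B) →
            (∀ {x y} → R x y → Reach S (f x) (f y)) →
            ∀ {x y} → Reach R x y → Reach S (f x) (f y)
reach-map f g (_ , nil) = reach-refl
reach-map f g (_ , cons r w) = reach-trans (g r) (reach-map f g (_ , w))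

-- Loop erasure: on Fin n every reachable point is reachable by a walk
-- without repeated vertices, hence by a walk of length < n.

module _ {n : ℕ} {R : Fin n → Fin n → Set} where
  open DecMembership (Fin._≟_ {n}) using (_∈?_)

  vertices : ∀ {x y k} → Walk R x y k → List (Fin n)
  vertices {x} nil = x ∷ []
  vertices {x} (cons r w) = x ∷ vertices w

  vertices-length : ∀ {x y k} (w : Walk R x y k) → length (vertices w) ≡ suc k
  vertices-length nil = refl
  vertices-length (cons r w) = cong suc (vertices-length w)

  SimpleWalk : Fin n → Fin n → Set
  SimpleWalk x y = ∃ λ k → Σ (Walk R x y k) λ w → Unique (vertices w)

  suffix : ∀ {x y z k} (w : Walk R y z k) → x ∈ vertices w → Unique (vertices w) → SimpleWalk x z
  suffix nil (here refl) u = _ , nil , [] ∷ []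
  suffix (cons r w) (here refl) u = _ , cons r w , u
  suffix (cons r w) (there p) (_ ∷ u) = suffix w p u

  erase-loops : ∀ {x z k} → Walk R x z k → SimpleWalk x z
  erase-loops nil = _ , nil , [] ∷ []
  erase-loops {x} (cons r w) with erase-loops w
  ... | _ , w' , u with x ∈? vertices w'
  ... | yes p = suffix w' p u
  ... | no x∉ = _ , cons r w' , AllP.¬Any⇒All¬ (vertices w') x∉ ∷ u

unique-length : ∀ {n} (xs : List (Fin n)) → Unique xs → length xs ≤ n
unique-length {zero} [] _ = z≤n
unique-length {suc n} [] _ = z≤n
unique-length {suc n} (x ∷ ys) (x∉ys ∷ u) =
  s≤s (subst (_≤ n) (remove-length ys x∉ys) (unique-length (remove ys x∉ys) (remove-unique ys x∉ys u)))
  where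
  -- delete x from the alphabet by punching it out of every entry
  remove : (ys : List (Fin (suc n))) → All (x ≢_) ys → List (Fin n)
  remove [] [] = []
  remove (y ∷ ys) (p ∷ ps) = punchOut p ∷ remove ys ps

  remove-length : ∀ ys ps → length (remove ys ps) ≡ length ys
  remove-length [] [] = refl
  remove-length (y ∷ ys) (p ∷ ps) = cong suc (remove-length ys ps)

  remove-fresh : ∀ {y} (q : x ≢ y) ys ps → All (y ≢_) ys → All (punchOut q ≢_) (remove ys ps)
  remove-fresh q [] [] [] = []
  remove-fresh q (_ ∷ ys) (p ∷ ps) (r ∷ rs) = (λ e → r (punchOut-injective q p e)) ∷ remove-fresh q ys ps rs

  remove-unique : ∀ ys ps → Unique ys → Unique (remove ys ps)
  remove-unique [] [] _ = []
  remove-unique (y ∷ ys) (p ∷ ps) (r ∷ u) = remove-fresh p ys ps r ∷ remove-unique ys ps u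

short-walk : ∀ {n} {R : Fin n → Fin n → Set} {x z} → Reach R x z → ∃ λ k → k < n × Walk R x z k
short-walk {R = R} (_ , w) with erase-loops {R = R} w
... | k , w' , u = k , subst (_≤ _) (vertices-length w') (unique-length (vertices w') u) , w'

iterate-commute : ∀ {A : Set} k (f : A → A) x → iterate k f (f x) ≡ f (iterate k f x)
iterate-commute zero f x = refl
iterate-commute (suc k) f x = cong f (iterate-commute k f x)

module Graph {n m : ℕ} (ends : Ends n m) where

  data Adj (F : Subset m) (u v : Fin n) : Set where
    edge : (e : Fin m) → T (e ∈ᵇ F) →
           (proj₁ (ends e) ≡ u × proj₂ (ends e) ≡ v) ⊎ (proj₂ (ends e) ≡ u × proj₁ (ends e) ≡ v) →
           Adj F u v

  Adj-sym : ∀ {F u v} → Adj F u v → Adj F v u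
  Adj-sym (edge e f (inj₁ (a , b))) = edge e f (inj₂ (b , a))
  Adj-sym (edge e f (inj₂ (a , b))) = edge e f (inj₁ (b , a))

  Adj-mono : ∀ {F F'} → (∀ e → T (e ∈ᵇ F) → T (e ∈ᵇ F')) → ∀ {u v} → Adj F u v → Adj F' u v
  Adj-mono h (edge e f r) = edge e (h e f) r

  Adj-inside : ∀ F V → (∀ e → T (e ∈ᵇ F) → T (proj₁ (ends e) ∈ᵇ V) × T (proj₂ (ends e) ∈ᵇ V)) →
               ∀ {u v} → Adj F u v → T (u ∈ᵇ V) × T (v ∈ᵇ V)
  Adj-inside F V h (edge e f (inj₁ (refl , refl))) = h e f
  Adj-inside F V h (edge e f (inj₂ (refl , refl))) = proj₂ (h e f) , proj₁ (h e f)

  Conn : Subset m → Fin n → Fin n → Set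
  Conn F = Reach (Adj F)

  conn-sym : ∀ {F u v} → Conn F u v → Conn F v u
  conn-sym = reach-sym Adj-sym

  conn-mono : ∀ {F F'} → (∀ e → T (e ∈ᵇ F) → T (e ∈ᵇ F')) → ∀ {u v} → Conn F u v → Conn F' u v
  conn-mono h = reach-map (λ x → x) (λ r → reach-step (Adj-mono h r))

  conn-inside : ∀ F V → (∀ e → T (e ∈ᵇ F) → T (proj₁ (ends e) ∈ᵇ V) × T (proj₂ (ends e) ∈ᵇ V)) →
                ∀ {u v} → T (u ∈ᵇ V) → Conn F u v → T (v ∈ᵇ V)
  conn-inside F V h uV c = reach-invariant (λ w → T (w ∈ᵇ V)) (λ r _ → proj₂ (Adj-inside F V h r)) c uV

  -- grow F S adds to S every vertex adjacent to S; k rounds reach exactly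
  -- the vertices at distance ≤ k from S.

  grow-inflationary : ∀ F S {v} → T (v ∈ᵇ S) → T (v ∈ᵇ grow ends F S)
  grow-inflationary F S {v} h = tab-intro {x = v} (∨-inl {v ∈ᵇ S} h)

  grow-adj : ∀ F S {u v} → T (u ∈ᵇ S) → Adj F u v → T (v ∈ᵇ grow ends F S)
  grow-adj F S {v = v} h (edge e f (inj₁ (refl , refl))) =
    tab-intro {x = v} (∨-inr {v ∈ᵇ S} (anyF-intro e (∧-intro {e ∈ᵇ F} f
      (∨-inl (∧-intro {proj₁ (ends e) ∈ᵇ S} h (==-intro refl))))))
  grow-adj F S {v = v} h (edge e f (inj₂ (refl , refl))) =
    tab-intro {x = v} (∨-inr {v ∈ᵇ S} (anyF-intro e (∧-intro {e ∈ᵇ F} f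
      (∨-inr (∧-intro {proj₂ (ends e) ∈ᵇ S} h (==-intro refl))))))

  iterate-inflationary : ∀ F S k {v} → T (v ∈ᵇ S) → T (v ∈ᵇ iterate k (grow ends F) S)
  iterate-inflationary F S zero h = h
  iterate-inflationary F S (suc k) h =
    grow-inflationary F (iterate k (grow ends F) S) (iterate-inflationary F S k h)

  grow-complete : ∀ F k S {u v j} → Walk (Adj F) u v j → j ≤ k → T (u ∈ᵇ S) →
                  T (v ∈ᵇ iterate k (grow ends F) S)
  grow-complete F k S nil _ h = iterate-inflationary F S k h
  grow-complete F (suc k) S {v = v} (cons r w) (s≤s j≤k) h =
    subst (λ Z → T (v ∈ᵇ Z)) (iterate-commute k (grow ends F) S)
      (grow-complete F k (grow ends F S) w j≤k (grow-adj F S h r))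

  grow-sound : ∀ F k S {v} → T (v ∈ᵇ iterate k (grow ends F) S) →
               ∃ λ u → T (u ∈ᵇ S) × Conn F u v
  grow-sound F zero S h = _ , h , reach-refl
  grow-sound F (suc k) S {v} h with ∨-elim {v ∈ᵇ Sₖ} (tab-elim {x = v} h)
    where Sₖ = iterate k (grow ends F) S
  ... | inj₁ p = grow-sound F k S p
  ... | inj₂ p with anyF-elim p
  ... | e , q with ∨-elim {(proj₁ (ends e) ∈ᵇ Sₖ) ∧ (proj₂ (ends e) == v)} (∧-snd {e ∈ᵇ F} q)
    where Sₖ = iterate k (grow ends F) S
  ... | inj₁ r with grow-sound F k S (∧-fst r)
  ... | u , uS , c = u , uS , reach-trans c (reach-step (edge e (∧-fst q)
                       (inj₁ (refl , ==-elim (∧-snd {proj₁ (ends e) ∈ᵇ iterate k (grow ends F) S} r)))))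
  grow-sound F (suc k) S {v} h | inj₂ p | e , q | inj₂ r with grow-sound F k S (∧-fst r)
  ... | u , uS , c = u , uS , reach-trans c (reach-step (edge e (∧-fst q)
                       (inj₂ (refl , ==-elim (∧-snd {proj₂ (ends e) ∈ᵇ iterate k (grow ends F) S} r)))))

  -- The Boolean test `connected` of Defs decides Conn: n rounds of growth
  -- suffice because a shortest connecting walk has length < n.
  connected-intro : ∀ F {u v} → Conn F u v → T (connected ends F u v)
  connected-intro F {u} c with short-walk c
  ... | k , k<n , w = grow-complete F n _ w (ℕP.<⇒≤ k<n) (tab-intro {x = u} (==-intro refl))

  connected-elim : ∀ F {u v} → T (connected ends F u v) → Conn F u v
  connected-elim F {u} h with grow-sound F n _ h
  ... | u' , p , c with ==-elim (tab-elim {x = u'} p)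
  ... | refl = c

  M-elim : ∀ F K' → T (Mᵇ ends F K') → ∀ u v → T (u ∈ᵇ K') → T (v ∈ᵇ K') → Conn F u v
  M-elim F K' h u v uK vK = connected-elim F (⇒-elim {(u ∈ᵇ K') ∧ (v ∈ᵇ K')}
    (allF-elim (allF-elim {P = λ u → allF λ v → ((u ∈ᵇ K') ∧ (v ∈ᵇ K')) ⇒ᵇ connected ends F u v} h u) v)
    (∧-intro {u ∈ᵇ K'} uK vK))

  M-intro : ∀ F K' → (∀ u v → T (u ∈ᵇ K') → T (v ∈ᵇ K') → Conn F u v) → T (Mᵇ ends F K')
  M-intro F K' h = allF-intro λ u → allF-intro λ v → ⇒-intro {(u ∈ᵇ K') ∧ (v ∈ᵇ K')} λ uv →
    connected-intro F (h u v (∧-fst {u ∈ᵇ K'} uv) (∧-snd {u ∈ᵇ K'} uv))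

  Anchored : Subset m → Subset n → Fin n → Set
  Anchored F X k = ∃ λ x → T (x ∈ᵇ X) × Conn F x k

contractV-in : ∀ {n} (X : Subset n) {a} → T (a ∈ᵇ X) → contractV X a ≡ zero
contractV-in X {a} h with a ∈ᵇ X
... | true = refl

contractV-out : ∀ {n} (X : Subset n) {a} → ¬ T (a ∈ᵇ X) → contractV X a ≡ suc a
contractV-out X {a} h with a ∈ᵇ X
... | true = ⊥-elim (h tt)
... | false = refl

contractV-zero : ∀ {n} (X : Subset n) {a} → contractV X a ≡ zero → T (a ∈ᵇ X)
contractV-zero X {a} h with a ∈ᵇ X
... | true = tt
contractV-zero X () | false

contractV-suc : ∀ {n} (X : Subset n) {a v} → contractV X a ≡ suc v → a ≡ v
contractV-suc X {a} h with a ∈ᵇ X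
contractV-suc X () | true
contractV-suc X refl | false = refl

-- M(H_X, K'_X) holds exactly when every vertex of K' is anchored to X in H:
-- in H_X the terminal X is the contracted vertex, and the other terminals
-- must be connected to it.
module Contraction {n m : ℕ} (ends : Ends n m) (X : Subset n) (F : Subset m) where
  open Graph ends using (Adj; edge; Conn; Anchored)
  module H/X = Graph (contractEnds ends X)

  F/X : Subset m
  F/X = contractEdges ends X F

  -- Every H-step either collapses into the contracted vertex or survives in H_X.
  project-adj : ∀ {a b} → Adj F a b → Reach (H/X.Adj F/X) (contractV X a) (contractV X b)
  project-adj {a} {b} (edge e f r) with T? ((proj₁ (ends e) ∈ᵇ X) ∧ (proj₂ (ends e) ∈ᵇ X))
  ... | yes both = subst₂ (Reach (H/X.Adj F/X)) (sym (collapse-a r)) (sym (collapse-b r)) reach-refl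
    where
    z₁ = contractV-in X (∧-fst {proj₁ (ends e) ∈ᵇ X} both)
    z₂ = contractV-in X (∧-snd {proj₁ (ends e) ∈ᵇ X} both)
    collapse-a : _ → contractV X a ≡ zero
    collapse-a (inj₁ (refl , refl)) = z₁
    collapse-a (inj₂ (refl , refl)) = z₂
    collapse-b : _ → contractV X b ≡ zero
    collapse-b (inj₁ (refl , refl)) = z₂
    collapse-b (inj₂ (refl , refl)) = z₁
  ... | no not-both = reach-step (H/X.edge e (tab-intro {x = e} (∧-intro {e ∈ᵇ F} f (not-intro not-both))) (image r))
    where
    image : _ → _
    image (inj₁ (refl , refl)) = inj₁ (refl , refl)
    image (inj₂ (refl , refl)) = inj₂ (refl , refl)

  project : ∀ {a b} → Conn F a b → Reach (H/X.Adj F/X) (contractV X a) (contractV X b)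
  project = reach-map (contractV X) project-adj

  -- Along H_X-walks from the contracted vertex, every ordinary vertex
  -- reached is anchored to X in H.
  FromX : Fin (suc n) → Set
  FromX w = (w ≡ zero) ⊎ ∃ λ v → (w ≡ suc v) × Anchored F X v

  FromX-adj : ∀ {a b} → Adj F a b → FromX (contractV X a) → FromX (contractV X b)
  FromX-adj {b = b} s q with T? (b ∈ᵇ X)
  ... | yes bX = inj₁ (contractV-in X bX)
  FromX-adj {a} {b} s (inj₁ p) | no bX = inj₂ (b , contractV-out X bX , a , contractV-zero X p , reach-step s)
  FromX-adj {a} {b} s (inj₂ (v , p , x , xX , c)) | no bX with contractV-suc X p
  ... | refl = inj₂ (b , contractV-out X bX , x , xX , reach-trans c (reach-step s))

  FromX-step : ∀ {w w'} → H/X.Adj F/X w w' → FromX w → FromX w'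
  FromX-step (H/X.edge e f (inj₁ (refl , refl))) =
    FromX-adj (edge e (∧-fst {e ∈ᵇ F} (tab-elim {x = e} f)) (inj₁ (refl , refl)))
  FromX-step (H/X.edge e f (inj₂ (refl , refl))) =
    FromX-adj (edge e (∧-fst {e ∈ᵇ F} (tab-elim {x = e} f)) (inj₂ (refl , refl)))

  M/X : Subset n → Bool
  M/X K' = Mᵇ (contractEnds ends X) F/X (contractK K' X)

  M/X-elim : ∀ K' → T (M/X K') → ∀ k → T (k ∈ᵇ K') → Anchored F X k
  M/X-elim K' h k kK with T? (k ∈ᵇ X)
  ... | yes kX = k , kX , reach-refl
  ... | no kX with reach-invariant FromX FromX-step
                     (H/X.M-elim F/X (contractK K' X) h zero (suc k) tt
                        (tab-intro {x = k} (∧-intro {k ∈ᵇ K'} kK (not-intro kX))))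
                     (inj₁ refl)
  ... | inj₁ ()
  ... | inj₂ (v , refl , anchor) = anchor

  M/X-intro : ∀ K' → (∀ k → T (k ∈ᵇ K') → Anchored F X k) → T (M/X K')
  M/X-intro K' anchored = H/X.M-intro F/X (contractK K' X) λ u v uK vK →
    reach-trans (reach-sym H/X.Adj-sym (from-zero u uK)) (from-zero v vK)
    where
    from-zero : ∀ u → T (u ∈ᵇ contractK K' X) → Reach (H/X.Adj F/X) zero u
    from-zero zero _ = reach-refl
    from-zero (suc k) h with anchored k (∧-fst {k ∈ᵇ K'} (tab-elim {x = k} h))
    ... | x , xX , c = subst₂ (Reach (H/X.Adj F/X)) (contractV-in X xX)
                         (contractV-out X (not-elim (∧-snd {k ∈ᵇ K'} (tab-elim {x = k} h)))) (project c)

module CompPart {n m : ℕ} (ends : Ends n m) (F : Subset m) (K' X : Subset n) where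
  open Graph ends using (Conn; connected-intro; connected-elim)

  π : LPart n
  π = compPart ends F K' X

  rel-elim : ∀ x y → T (relᵇ π x y) → T (x ∈ᵇ X) × T (y ∈ᵇ X) × Conn F x y
  rel-elim x y h =
    let h' = tab²-elim (λ x y → (x ∈ᵇ X) ∧ (y ∈ᵇ X) ∧ connected ends F x y) x y h in
    ∧-fst {x ∈ᵇ X} h' , ∧-fst {y ∈ᵇ X} (∧-snd {x ∈ᵇ X} h') ,
    connected-elim F (∧-snd {y ∈ᵇ X} (∧-snd {x ∈ᵇ X} h'))

  rel-intro : ∀ x y → T (x ∈ᵇ X) → T (y ∈ᵇ X) → Conn F x y → T (relᵇ π x y)
  rel-intro x y xX yX c = tab²-intro (λ x y → (x ∈ᵇ X) ∧ (y ∈ᵇ X) ∧ connected ends F x y) x y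
    (∧-intro {x ∈ᵇ X} xX (∧-intro {y ∈ᵇ X} yX (connected-intro F c)))

  lab-elim : ∀ x → T (labᵇ π x) → T (x ∈ᵇ X) × ∃ λ k → T (k ∈ᵇ K') × Conn F x k
  lab-elim x h with tab-elim {f = λ x → (x ∈ᵇ X) ∧ anyF λ k → (k ∈ᵇ K') ∧ connected ends F x k} {x} h
  ... | h' with anyF-elim {P = λ k → (k ∈ᵇ K') ∧ connected ends F x k} (∧-snd {x ∈ᵇ X} h')
  ... | k , q = ∧-fst {x ∈ᵇ X} h' , k , ∧-fst {k ∈ᵇ K'} q , connected-elim F (∧-snd {k ∈ᵇ K'} q)

  lab-intro : ∀ x k → T (x ∈ᵇ X) → T (k ∈ᵇ K') → Conn F x k → T (labᵇ π x)
  lab-intro x k xX kK c = tab-intro {f = λ x → (x ∈ᵇ X) ∧ anyF λ k → (k ∈ᵇ K') ∧ connected ends F x k} {x}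
    (∧-intro {x ∈ᵇ X} xX (anyF-intro {P = λ k → (k ∈ᵇ K') ∧ connected ends F x k} k
      (∧-intro {k ∈ᵇ K'} kK (connected-intro F c))))

-- The join of labelled partitions closes rel π ∪ rel σ under composition by
-- iterated squaring; k squarings capture exactly the chains of length ≤ 2^k.

square : ∀ {n} → (Fin n → Fin n → Bool) → Fin n → Fin n → Bool
square R x y = R x y ∨ anyF λ z → R x z ∧ R z y

Holds : ∀ {n} → (Fin n → Fin n → Bool) → Fin n → Fin n → Set
Holds R x y = T (R x y)

square-sound : ∀ {n} (R : Fin n → Fin n → Bool) (C : Fin n → Fin n → Set) →
  (∀ x y → T (R x y) → C x y) → (∀ {x y z} → C x y → C y z → C x z) →
  ∀ k x y → T (iterate k square R x y) → C x y
square-sound R C base tr zero x y h = base x y h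
square-sound R C base tr (suc k) x y h with ∨-elim {iterate k square R x y} h
... | inj₁ p = square-sound R C base tr k x y p
... | inj₂ p with anyF-elim {P = λ z → iterate k square R x z ∧ iterate k square R z y} p
... | z , q = tr (square-sound R C base tr k x z (∧-fst {iterate k square R x z} q))
                 (square-sound R C base tr k z y (∧-snd {iterate k square R x z} q))

square-complete : ∀ {n} (R : Fin n → Fin n → Bool) k {x y j} → Walk (Holds R) x y j →
                  1 ≤ j → j ≤ 2 ℕ.^ k → T (iterate k square R x y)
square-complete R zero (cons r nil) _ _ = r
square-complete R zero (cons r (cons _ _)) _ (s≤s ())
square-complete R (suc k) {x} {y} {j} w 1≤j j≤ with j ℕP.≤? 2 ℕ.^ k
... | yes j≤half = ∨-inl (square-complete R k w 1≤j j≤half)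
... | no j≰half = ∨-inr {iterate k square R x y}
      (anyF-intro {P = λ z → iterate k square R x z ∧ iterate k square R z y} z
        (∧-intro {iterate k square R x z} (square-complete R k w₁ (ℕP.m^n>0 2 k) ℕP.≤-refl)
                                          (square-complete R k w₂ rest≥1 rest≤)))
  where
  half = 2 ℕ.^ k
  half<j : half < j
  half<j = ℕP.≰⇒> j≰half
  j≡ : half ℕ.+ (j ℕ.∸ half) ≡ j
  j≡ = ℕP.m+[n∸m]≡n (ℕP.<⇒≤ half<j)
  halves = walk-split half (subst (Walk (Holds R) x y) (sym j≡) w)
  z = proj₁ halves
  w₁ = proj₁ (proj₂ halves)
  w₂ = proj₂ (proj₂ halves)
  rest≥1 : 1 ≤ j ℕ.∸ half
  rest≥1 = ℕP.m<n⇒0<n∸m half<j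
  rest≤ : j ℕ.∸ half ≤ half
  rest≤ = ℕP.+-cancelˡ-≤ half _ _ (subst (_≤ half ℕ.+ half) (sym j≡)
            (subst (j ≤_) (cong (half ℕ.+_) (ℕP.+-identityʳ half)) j≤))

n≤2^n : ∀ n → n ≤ 2 ℕ.^ n
n≤2^n zero = z≤n
n≤2^n (suc n) = ℕP.+-mono-≤ (ℕP.m^n>0 2 n) (subst (n ≤_) (sym (ℕP.+-identityʳ _)) (n≤2^n n))

module Terminals {n m : ℕ} {ends : Ends n m} {K : Subset n} (S : KSplitting ends K) where
  open KSplitting S

  k₁ k₂ : Fin n
  k₁ = proj₁ K¹-nonempty
  k₂ = proj₁ K²-nonempty

  k₁∈K¹ : T (k₁ ∈ᵇ K¹)
  k₁∈K¹ = ≡-to-T ([]=⇒lookup (proj₂ K¹-nonempty))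

  k₂∈K² : T (k₂ ∈ᵇ K²)
  k₂∈K² = ≡-to-T ([]=⇒lookup (proj₂ K²-nonempty))

module Splitting {n m : ℕ} {ends : Ends n m} {K : Subset n} (S : KSplitting ends K)
  (F₁ F₂ : Subset m)
  (F₁⊆E¹ : ∀ e → T (e ∈ᵇ F₁) → T (e ∈ᵇ KSplitting.E¹ S))
  (F₂⊆E² : ∀ e → T (e ∈ᵇ F₂) → T (e ∈ᵇ KSplitting.E² S)) where
  open KSplitting S
  open Terminals S
  open Graph ends

  F : Subset m
  F = F₁ ∪ F₂

  inside₁ : ∀ e → T (e ∈ᵇ F₁) → T (proj₁ (ends e) ∈ᵇ V¹) × T (proj₂ (ends e) ∈ᵇ V¹)
  inside₁ e f = let both = sub¹ e (T-to-≡ (F₁⊆E¹ e f)) in ≡-to-T (proj₁ both) , ≡-to-T (proj₂ both)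

  inside₂ : ∀ e → T (e ∈ᵇ F₂) → T (proj₁ (ends e) ∈ᵇ V²) × T (proj₂ (ends e) ∈ᵇ V²)
  inside₂ e f = let both = sub² e (T-to-≡ (F₂⊆E² e f)) in ≡-to-T (proj₁ both) , ≡-to-T (proj₂ both)

  F₁⊆F : ∀ e → T (e ∈ᵇ F₁) → T (e ∈ᵇ F)
  F₁⊆F = ∪-inl F₁ F₂

  F₂⊆F : ∀ e → T (e ∈ᵇ F₂) → T (e ∈ᵇ F)
  F₂⊆F = ∪-inr F₁ F₂

  X⊆V¹ : ∀ x → T (x ∈ᵇ X) → T (x ∈ᵇ V¹)
  X⊆V¹ x h = proj₁ (∩-elim V¹ V² x h)

  X⊆V² : ∀ x → T (x ∈ᵇ X) → T (x ∈ᵇ V²)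
  X⊆V² x h = proj₂ (∩-elim V¹ V² x h)

  -- One side (Vₐ, Fₐ) of the splitting against the other (V_b, F_b).  An
  -- F-walk from Vₐ to V_b must pass through X = Vₐ ∩ V_b, and until it
  -- does it only uses edges of Fₐ.
  module Side (Vₐ V_b : Subset n) (Fₐ F_b : Subset m)
    (insideₐ : ∀ e → T (e ∈ᵇ Fₐ) → T (proj₁ (ends e) ∈ᵇ Vₐ) × T (proj₂ (ends e) ∈ᵇ Vₐ))
    (inside_b : ∀ e → T (e ∈ᵇ F_b) → T (proj₁ (ends e) ∈ᵇ V_b) × T (proj₂ (ends e) ∈ᵇ V_b))
    (X-intro : ∀ x → T (x ∈ᵇ Vₐ) → T (x ∈ᵇ V_b) → T (x ∈ᵇ X))
    (split : ∀ e → T (e ∈ᵇ F) → T (e ∈ᵇ Fₐ) ⊎ T (e ∈ᵇ F_b)) where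

    -- Invariant along F-walks from k: either k is already anchored to X
    -- in Fₐ, or we are still in Vₐ \ X, reached from k inside Fₐ.
    Before : Fin n → Fin n → Set
    Before k w = Anchored Fₐ X k ⊎ (T (w ∈ᵇ Vₐ) × ¬ T (w ∈ᵇ X) × Conn Fₐ k w)

    Before-step : ∀ k {w w'} → Adj F w w' → Before k w → Before k w'
    Before-step k s (inj₁ anchor) = inj₁ anchor
    Before-step k {w} {w'} (edge e f r) (inj₂ (wₐ , w∉X , c)) with split e f
    ... | inj₂ e_b = ⊥-elim (w∉X (X-intro w wₐ (proj₁ (Adj-inside F_b V_b inside_b (edge e e_b r)))))
    ... | inj₁ eₐ with T? (w' ∈ᵇ X)
    ... | yes w'X = inj₁ (w' , w'X , conn-sym (reach-trans c (reach-step (edge e eₐ r))))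
    ... | no w'∉X = inj₂ (proj₂ (Adj-inside Fₐ Vₐ insideₐ (edge e eₐ r)) , w'∉X , reach-trans c (reach-step (edge e eₐ r)))

    crossing : ∀ k k' → T (k ∈ᵇ Vₐ) → T (k' ∈ᵇ V_b) → Conn F k k' → Anchored Fₐ X k
    crossing k k' kₐ k'_b c with T? (k ∈ᵇ X)
    ... | yes kX = k , kX , reach-refl
    ... | no k∉X with reach-invariant (Before k) (Before-step k) c (inj₂ (kₐ , k∉X , reach-refl))
    ... | inj₁ anchor = anchor
    ... | inj₂ (k'ₐ , k'∉X , _) = ⊥-elim (k'∉X (X-intro k' k'ₐ k'_b))

  split₁₂ : ∀ e → T (e ∈ᵇ F) → T (e ∈ᵇ F₁) ⊎ T (e ∈ᵇ F₂)
  split₁₂ = ∪-elim F₁ F₂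

  split₂₁ : ∀ e → T (e ∈ᵇ F) → T (e ∈ᵇ F₂) ⊎ T (e ∈ᵇ F₁)
  split₂₁ e f with split₁₂ e f
  ... | inj₁ e₁ = inj₂ e₁
  ... | inj₂ e₂ = inj₁ e₂

  module Side₁ = Side V¹ V² F₁ F₂ inside₁ inside₂ (∩-intro V¹ V²) split₁₂
  module Side₂ = Side V² V¹ F₂ F₁ inside₂ inside₁ (λ x b a → ∩-intro V¹ V² x a b) split₂₁

  module Π₁ = CompPart ends F₁ K¹ X
  module Π₂ = CompPart ends F₂ K² X

  π₁ π₂ : LPart n
  π₁ = Π₁.π
  π₂ = Π₂.π

  joinBase : Fin n → Fin n → Bool
  joinBase x y = relᵇ π₁ x y ∨ relᵇ π₂ x y

  ConnX : Fin n → Fin n → Set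
  ConnX x y = T (x ∈ᵇ X) × T (y ∈ᵇ X) × Conn F x y

  join-sound : ∀ x y → T (joinRel π₁ π₂ x y) → ConnX x y
  join-sound = square-sound joinBase ConnX base compose n
    where
    base : ∀ x y → T (joinBase x y) → ConnX x y
    base x y h with ∨-elim {relᵇ π₁ x y} h
    ... | inj₁ p = let (xX , yX , c) = Π₁.rel-elim x y p in xX , yX , conn-mono F₁⊆F c
    ... | inj₂ p = let (xX , yX , c) = Π₂.rel-elim x y p in xX , yX , conn-mono F₂⊆F c
    compose : ∀ {x y z} → ConnX x y → ConnX y z → ConnX x z
    compose (xX , _ , c) (_ , zX , d) = xX , zX , reach-trans c d

  -- Invariant along F-walks from x ∈ X: the current vertex is reached by a
  -- chain of blocks of π₁, π₂ to some z ∈ X, followed by a walk inside one side.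
  ViaBlocks : Fin n → Fin n → Set
  ViaBlocks x w = ∃ λ z → T (z ∈ᵇ X) × Reach (Holds joinBase) x z × (Conn F₁ z w ⊎ Conn F₂ z w)

  ViaBlocks-step : ∀ x {w w'} → Adj F w w' → ViaBlocks x w → ViaBlocks x w'
  ViaBlocks-step x {w} (edge e f r) (z , zX , chain , c) with split₁₂ e f | c
  ... | inj₁ e₁ | inj₁ c₁ = z , zX , chain , inj₁ (reach-trans c₁ (reach-step (edge e e₁ r)))
  ... | inj₂ e₂ | inj₂ c₂ = z , zX , chain , inj₂ (reach-trans c₂ (reach-step (edge e e₂ r)))
  ... | inj₁ e₁ | inj₂ c₂ =
    w , wX , reach-trans chain (reach-step (∨-inr {relᵇ π₁ z w} (Π₂.rel-intro z w zX wX c₂))) ,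
    inj₁ (reach-step (edge e e₁ r))
    where
    wX = ∩-intro V¹ V² w (proj₁ (Adj-inside F₁ V¹ inside₁ (edge e e₁ r)))
                         (conn-inside F₂ V² inside₂ (X⊆V² z zX) c₂)
  ... | inj₂ e₂ | inj₁ c₁ =
    w , wX , reach-trans chain (reach-step (∨-inl {relᵇ π₁ z w} (Π₁.rel-intro z w zX wX c₁))) ,
    inj₂ (reach-step (edge e e₂ r))
    where
    wX = ∩-intro V¹ V² w (conn-inside F₁ V¹ inside₁ (X⊆V¹ z zX) c₁)
                         (proj₁ (Adj-inside F₂ V² inside₂ (edge e e₂ r)))

  join-complete : ∀ x y → T (x ∈ᵇ X) → T (y ∈ᵇ X) → Conn F x y → T (joinRel π₁ π₂ x y)
  join-complete x y xX yX c with x Fin.≟ y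
  ... | yes refl = square-complete joinBase n (cons (∨-inl {relᵇ π₁ x x} (Π₁.rel-intro x x xX xX reach-refl)) nil)
                     (s≤s z≤n) (ℕP.m^n>0 2 n)
  ... | no x≢y with reach-invariant (ViaBlocks x) (ViaBlocks-step x) c (x , xX , reach-refl , inj₁ reach-refl)
  ... | z , zX , chain , last with short-walk (reach-trans chain (reach-step (last-block last)))
    where
    last-block : Conn F₁ z y ⊎ Conn F₂ z y → Holds joinBase z y
    last-block (inj₁ c₁) = ∨-inl {relᵇ π₁ z y} (Π₁.rel-intro z y zX yX c₁)
    last-block (inj₂ c₂) = ∨-inr {relᵇ π₁ z y} (Π₂.rel-intro z y zX yX c₂)
  ... | zero , _ , nil = ⊥-elim (x≢y refl)
  ... | suc k , k<n , w = square-complete joinBase n w (s≤s z≤n) (ℕP.≤-trans (ℕP.<⇒≤ k<n) (n≤2^n n))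

  open Contraction ends X F₁ using () renaming (M/X to M₁/X; M/X-elim to M₁/X-elim; M/X-intro to M₁/X-intro)
  open Contraction ends X F₂ using () renaming (M/X to M₂/X; M/X-elim to M₂/X-elim; M/X-intro to M₂/X-intro)

  M₁ M₂ : Bool
  M₁ = M₁/X K¹
  M₂ = M₂/X K²

  π₁∨π₂ : LPart n
  π₁∨π₂ = π₁ ∨ᴸ π₂

  labelled : Fin n → Bool
  labelled = labᵇ π₁∨π₂

  rel-join-elim : ∀ x y → T (relᵇ π₁∨π₂ x y) → T (joinRel π₁ π₂ x y)
  rel-join-elim = tab²-elim (joinRel π₁ π₂)

  rel-join-intro : ∀ x y → T (joinRel π₁ π₂ x y) → T (relᵇ π₁∨π₂ x y)
  rel-join-intro = tab²-intro (joinRel π₁ π₂)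

  labelled-elim : ∀ x → T (labelled x) → T (x ∈ᵇ X) × ∃ λ k → T (k ∈ᵇ K) × Conn F x k
  labelled-elim x h with anyF-elim {P = λ z → joinRel π₁ π₂ x z ∧ (labᵇ π₁ z ∨ labᵇ π₂ z)} (tab-elim {x = x} h)
  ... | z , q with join-sound x z (∧-fst {joinRel π₁ π₂ x z} q) | ∨-elim {labᵇ π₁ z} (∧-snd {joinRel π₁ π₂ x z} q)
  ... | xX , _ , cxz | inj₁ l₁ = let (_ , k , kK , c) = Π₁.lab-elim z l₁ in
        xX , k , proj₁ (∩-elim K V¹ k kK) , reach-trans cxz (conn-mono F₁⊆F c)
  ... | xX , _ , cxz | inj₂ l₂ = let (_ , k , kK , c) = Π₂.lab-elim z l₂ in
        xX , k , proj₁ (∩-elim K V² k kK) , reach-trans cxz (conn-mono F₂⊆F c)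

  labelled-anchor : T M₁ → T M₂ → ∀ k → T (k ∈ᵇ K) →
                    ∃ λ z → T (z ∈ᵇ X) × Conn F z k × T (labᵇ π₁ z ∨ labᵇ π₂ z)
  labelled-anchor h₁ h₂ k kK with ∨-elim {k ∈ᵇ V¹} (≡-to-T (V-cover k))
  ... | inj₁ k₁ = let kK¹ = ∩-intro K V¹ k kK k₁
                      (z , zX , c) = M₁/X-elim K¹ h₁ k kK¹ in
                  z , zX , conn-mono F₁⊆F c , ∨-inl (Π₁.lab-intro z k zX kK¹ c)
  ... | inj₂ k₂ = let kK² = ∩-intro K V² k kK k₂
                      (z , zX , c) = M₂/X-elim K² h₂ k kK² in
                  z , zX , conn-mono F₂⊆F c , ∨-inr {labᵇ π₁ z} (Π₂.lab-intro z k zX kK² c)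

  labelled-intro : T M₁ → T M₂ → ∀ x k → T (x ∈ᵇ X) → T (k ∈ᵇ K) → Conn F x k → T (labelled x)
  labelled-intro h₁ h₂ x k xX kK c with labelled-anchor h₁ h₂ k kK
  ... | z , zX , czk , l = tab-intro {x = x}
        (anyF-intro {P = λ z → joinRel π₁ π₂ x z ∧ (labᵇ π₁ z ∨ labᵇ π₂ z)} z
          (∧-intro {joinRel π₁ π₂ x z} (join-complete x z xX zX (reach-trans c (conn-sym czk))) l))

  m-elim : T (mᵇ π₁∨π₂) → ∀ x y → T (labelled x) → T (labelled y) → T (relᵇ π₁∨π₂ x y)
  m-elim h x y lx ly = ⇒-elim {labelled x ∧ labelled y}
    (allF-elim (allF-elim {P = λ x → allF λ y → (labelled x ∧ labelled y) ⇒ᵇ relᵇ π₁∨π₂ x y}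
      (∧-snd {anyF labelled} h) x) y)
    (∧-intro {labelled x} lx ly)

  m-intro : ∃ (λ x → T (labelled x)) → (∀ x y → T (labelled x) → T (labelled y) → T (relᵇ π₁∨π₂ x y)) →
            T (mᵇ π₁∨π₂)
  m-intro (x , lx) f = ∧-intro {anyF labelled} (anyF-intro x lx)
    (allF-intro λ x → allF-intro λ y → ⇒-intro {labelled x ∧ labelled y} λ l →
      f x y (∧-fst {labelled x} l) (∧-snd {labelled x} l))

  -- If K is connected in F, both contracted graphs are Kⁱ_X-connected
  -- (every terminal of one side reaches the other side through X), and the
  -- labelled blocks of π₁ ∨ π₂ all coincide.
  connected⇒parts : T (Mᵇ ends F K) → T M₁ × T M₂ × T (mᵇ π₁∨π₂)
  connected⇒parts h = h₁ , h₂ , hm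
    where
    K-conn : ∀ u v → T (u ∈ᵇ K) → T (v ∈ᵇ K) → Conn F u v
    K-conn = M-elim F K h
    h₁ : T M₁
    h₁ = M₁/X-intro K¹ λ k kK¹ → let (kK , kV¹) = ∩-elim K V¹ k kK¹ in
      Side₁.crossing k k₂ kV¹ (proj₂ (∩-elim K V² k₂ k₂∈K²)) (K-conn k k₂ kK (proj₁ (∩-elim K V² k₂ k₂∈K²)))
    h₂ : T M₂
    h₂ = M₂/X-intro K² λ k kK² → let (kK , kV²) = ∩-elim K V² k kK² in
      Side₂.crossing k k₁ kV² (proj₂ (∩-elim K V¹ k₁ k₁∈K¹)) (K-conn k k₁ kK (proj₁ (∩-elim K V¹ k₁ k₁∈K¹)))
    hm : T (mᵇ π₁∨π₂)
    hm = m-intro (let (x , xX , c) = M₁/X-elim K¹ h₁ k₁ k₁∈K¹ in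
                  x , labelled-intro h₁ h₂ x k₁ xX (proj₁ (∩-elim K V¹ k₁ k₁∈K¹)) (conn-mono F₁⊆F c))
                 λ x y lx ly →
                   let (xX , kx , kxK , cx) = labelled-elim x lx
                       (yX , ky , kyK , cy) = labelled-elim y ly in
                   rel-join-intro x y (join-complete x y xX yX
                     (reach-trans cx (reach-trans (K-conn kx ky kxK kyK) (conn-sym cy))))

  -- Conversely each terminal is joined to a labelled vertex of X, and those
  -- are joined to each other since π₁ ∨ π₂ has a single labelled block.
  parts⇒connected : T M₁ → T M₂ → T (mᵇ π₁∨π₂) → T (Mᵇ ends F K)
  parts⇒connected h₁ h₂ hm = M-intro F K λ u v uK vK →
    let (xu , xuX , cu , _) = labelled-anchor h₁ h₂ u uK
        (xv , xvX , cv , _) = labelled-anchor h₁ h₂ v vK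
        lu = labelled-intro h₁ h₂ xu u xuX uK cu
        lv = labelled-intro h₁ h₂ xv v xvX vK cv
        (_ , _ , cxx) = join-sound xu xv (rel-join-elim xu xv (m-elim hm xu xv lu lv)) in
    reach-trans (conn-sym cu) (reach-trans cxx cv)

  M-splits : Mᵇ ends F K ≡ M₁ ∧ (M₂ ∧ mᵇ π₁∨π₂)
  M-splits = bool-ext
    (λ h → let (a , b , c) = connected⇒parts h in ∧-intro {M₁} a (∧-intro {M₂} b c))
    (λ h → parts⇒connected (∧-fst {M₁} h) (∧-fst {M₂} (∧-snd {M₁} h)) (∧-snd {M₂} (∧-snd {M₁} h)))

vec-ext : ∀ {A : Set} {k} (u v : Vec A k) → (∀ i → lookup u i ≡ lookup v i) → u ≡ v
vec-ext u v h = trans (sym (tabulate∘lookup u)) (trans (tabulate-cong h) (tabulate∘lookup v))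

eqLPart-elim : ∀ {n} (π σ : LPart n) → T (eqLPart π σ) → π ≡ σ
eqLPart-elim (lpart r l) (lpart r' l') h = cong₂ lpart
  (vec-ext r r' λ x → vec-ext (lookup r x) (lookup r' x) λ y →
    ⇔-to-≡ (allF-elim (allF-elim {P = λ x → allF λ y → lookup (lookup r x) y ⇔ᵇ lookup (lookup r' x) y}
                        (∧-fst {allF λ x → allF λ y → lookup (lookup r x) y ⇔ᵇ lookup (lookup r' x) y} h) x) y))
  (vec-ext l l' λ x → ⇔-to-≡ (allF-elim {P = λ x → lookup l x ⇔ᵇ lookup l' x}
    (∧-snd {allF λ x → allF λ y → lookup (lookup r x) y ⇔ᵇ lookup (lookup r' x) y} h) x))

eqLPart-refl : ∀ {n} (π : LPart n) → T (eqLPart π π)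
eqLPart-refl (lpart r l) = ∧-intro {allF λ x → allF λ y → lookup (lookup r x) y ⇔ᵇ lookup (lookup r x) y}
  (allF-intro λ x → allF-intro λ y → ⇔-refl (lookup (lookup r x) y))
  (allF-intro λ x → ⇔-refl (lookup l x))

allVecs-complete : ∀ {A : Set} (xs : List A) → (∀ a → a ∈ xs) → ∀ {k} (v : Vec A k) → v ∈ allVecs xs k
allVecs-complete xs every [] = here refl
allVecs-complete xs every {suc k} (a ∷ v) = go xs (every a)
  where
  go : ∀ ys → a ∈ ys → (a ∷ v) ∈ List.concatMap (λ x → List.map (x ∷_) (allVecs xs k)) ys
  go (y ∷ ys) (here refl) = ∈-++⁺ˡ (∈-map⁺ (a ∷_) (allVecs-complete xs every v))
  go (y ∷ ys) (there p) = ∈-++⁺ʳ (List.map (y ∷_) (allVecs xs k)) (go ys p)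

allVecs-unique : ∀ {A : Set} (xs : List A) → Unique xs → ∀ k → Unique (allVecs xs k)
allVecs-unique xs u zero = [] ∷ []
allVecs-unique xs u (suc k) = go xs u
  where
  withHeads : List _ → List (Vec _ (suc k))
  withHeads = List.concatMap (λ x → List.map (x ∷_) (allVecs xs k))

  head-in : ∀ ys {w} → w ∈ withHeads ys → Vec.head w ∈ ys
  head-in (y ∷ ys) p with ∈-++⁻ (List.map (y ∷_) (allVecs xs k)) p
  ... | inj₁ q with ∈-map⁻ (y ∷_) q
  ... | _ , _ , refl = here refl
  head-in (y ∷ ys) p | inj₂ q = there (head-in ys q)

  go : ∀ ys → Unique ys → Unique (withHeads ys)
  go [] [] = []
  go (y ∷ ys) (y∉ys ∷ u') = UniqueP.++⁺ (UniqueP.map⁺ ∷-injectiveʳ (allVecs-unique xs u k)) (go ys u') disjoint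
    where
    disjoint : Disjoint (List.map (y ∷_) (allVecs xs k)) (withHeads ys)
    disjoint (p , q) with ∈-map⁻ (y ∷_) p
    ... | _ , _ , refl = All.lookup y∉ys (head-in ys q) refl

bools-complete : ∀ (b : Bool) → b ∈ (true ∷ false ∷ [])
bools-complete true = here refl
bools-complete false = there (here refl)

bools-unique : Unique (true ∷ false ∷ [])
bools-unique = ((λ ()) ∷ []) ∷ [] ∷ []

mkLPart : ∀ {n} → Vec (Vec Bool n) n × Subset n → LPart n
mkLPart (r , l) = lpart r l

mkLPart-injective : ∀ {n} {a b : Vec (Vec Bool n) n × Subset n} → mkLPart a ≡ mkLPart b → a ≡ b
mkLPart-injective {a = r , l} {b = .r , .l} refl = refl

ΠLX-unique : ∀ {n} (X K : Subset n) → Unique (ΠLX X K)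
ΠLX-unique {n} X K = UniqueP.filter⁺ _ (UniqueP.filter⁺ _ (UniqueP.map⁺ mkLPart-injective
  (UniqueP.cartesianProduct⁺ (allVecs-unique _ (allVecs-unique _ bools-unique n) n) (allVecs-unique _ bools-unique n))))

ΠLX-complete : ∀ {n} (X K : Subset n) (π : LPart n) → T (isLPart X π) →
               T (leqᵇ (πX X K) π ∧ (anyF λ x → labᵇ π x)) → π ∈ ΠLX X K
ΠLX-complete {n} X K (lpart r l) valid above = ∈-filter⁺ _ (∈-filter⁺ _
  (∈-map⁺ mkLPart (∈-cartesianProduct⁺ (allVecs-complete _ (allVecs-complete _ bools-complete) r)
                                        (allVecs-complete _ bools-complete l))) valid) above

module CompPartMember {n m : ℕ} (ends : Ends n m) (F : Subset m) (K' X K : Subset n)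
  (K∩X⊆K' : ∀ x → T (x ∈ᵇ X) → T (x ∈ᵇ K) → T (x ∈ᵇ K'))
  (meets : ∃ λ x → T (x ∈ᵇ X) × ∃ λ k → T (k ∈ᵇ K') × Graph.Conn ends F x k) where
  open Graph ends using (conn-sym)
  open CompPart ends F K' X

  valid : T (isLPart X π)
  valid = allF-intro λ x → allF-intro λ y →
    ∧-intro {relᵇ π x y ⇒ᵇ ((x ∈ᵇ X) ∧ (y ∈ᵇ X))}
      (⇒-intro {relᵇ π x y} λ h → let (xX , yX , _) = rel-elim x y h in ∧-intro {x ∈ᵇ X} xX yX)
    (∧-intro {(x ∈ᵇ X) ⇒ᵇ relᵇ π x x}
      (⇒-intro {x ∈ᵇ X} λ xX → rel-intro x x xX xX reach-refl)
    (∧-intro {relᵇ π x y ⇒ᵇ relᵇ π y x}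
      (⇒-intro {relᵇ π x y} λ h → let (xX , yX , c) = rel-elim x y h in rel-intro y x yX xX (conn-sym c))
    (∧-intro {allF λ z → (relᵇ π x y ∧ relᵇ π y z) ⇒ᵇ relᵇ π x z}
      (allF-intro λ z → ⇒-intro {relᵇ π x y ∧ relᵇ π y z} λ h →
         let (xX , _ , c) = rel-elim x y (∧-fst {relᵇ π x y} h)
             (_ , zX , d) = rel-elim y z (∧-snd {relᵇ π x y} h) in rel-intro x z xX zX (reach-trans c d))
    (∧-intro {labᵇ π x ⇒ᵇ (x ∈ᵇ X)}
      (⇒-intro {labᵇ π x} λ h → proj₁ (lab-elim x h))
      (⇒-intro {relᵇ π x y} λ h → let (xX , yX , c) = rel-elim x y h in
         ⇔-intro {labᵇ π x}
           (λ l → let (_ , k , kK , d) = lab-elim x l in lab-intro y k yX kK (reach-trans (conn-sym c) d))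
           (λ l → let (_ , k , kK , d) = lab-elim y l in lab-intro x k xX kK (reach-trans c d)))))))

  above-πX : T (leqᵇ (πX X K) π)
  above-πX = ∧-intro {allF λ x → allF λ y → relᵇ (πX X K) x y ⇒ᵇ relᵇ π x y}
    (allF-intro λ x → allF-intro λ y → ⇒-intro {relᵇ (πX X K) x y} λ h →
      let h' = tab²-elim (λ x y → (x ∈ᵇ X) ∧ (x == y)) x y h
          xX = ∧-fst {x ∈ᵇ X} h' in
      subst (λ y → T (relᵇ π x y)) (==-elim (∧-snd {x ∈ᵇ X} h')) (rel-intro x x xX xX reach-refl))
    (allF-intro λ x → ⇒-intro {labᵇ (πX X K) x} λ h →
      let h' = tab-elim {f = λ x → (x ∈ᵇ X) ∧ (x ∈ᵇ K)} {x} h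
          xX = ∧-fst {x ∈ᵇ X} h' in
      lab-intro x x xX (K∩X⊆K' x xX (∧-snd {x ∈ᵇ X} h')) reach-refl)

  has-label : T (anyF (labᵇ π))
  has-label = let (x , xX , k , kK , c) = meets in anyF-intro x (lab-intro x k xX kK c)

  member : π ∈ ΠLX X K
  member = ΠLX-complete X K π valid (∧-intro {leqᵇ (πX X K) π} above-πX has-label)

module Sums {c ℓ} (CR : CommutativeRing c ℓ) where
  open CommutativeRing CR renaming (refl to ≈-refl; sym to ≈-sym; trans to ≈-trans) hiding (zero)
  open ≈-Reasoning setoid

  ∑ : {A : Set} → List A → (A → Carrier) → Carrier
  ∑ = Σ-list CR

  ι : Bool → Carrier
  ι = ind CR

  ∑-cong : ∀ {A : Set} (xs : List A) {f g : A → Carrier} → (∀ x → f x ≈ g x) → ∑ xs f ≈ ∑ xs g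
  ∑-cong [] h = ≈-refl
  ∑-cong (x ∷ xs) h = +-cong (h x) (∑-cong xs h)

  ∑-zero : ∀ {A : Set} (xs : List A) {f : A → Carrier} → (∀ x → f x ≈ 0#) → ∑ xs f ≈ 0#
  ∑-zero [] h = ≈-refl
  ∑-zero (x ∷ xs) h = ≈-trans (+-cong (h x) (∑-zero xs h)) (+-identityˡ 0#)

  +-interchange : ∀ a b c d → (a + b) + (c + d) ≈ (a + c) + (b + d)
  +-interchange a b c d = begin
    (a + b) + (c + d)   ≈⟨ +-assoc a b (c + d) ⟩
    a + (b + (c + d))   ≈⟨ +-congˡ (≈-sym (+-assoc b c d)) ⟩
    a + ((b + c) + d)   ≈⟨ +-congˡ (+-congʳ (+-comm b c)) ⟩
    a + ((c + b) + d)   ≈⟨ +-congˡ (+-assoc c b d) ⟩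
    a + (c + (b + d))   ≈⟨ ≈-sym (+-assoc a c (b + d)) ⟩
    (a + c) + (b + d)   ∎

  ∑-+ : ∀ {A : Set} (xs : List A) (f g : A → Carrier) → ∑ xs (λ x → f x + g x) ≈ ∑ xs f + ∑ xs g
  ∑-+ [] f g = ≈-sym (+-identityˡ 0#)
  ∑-+ (x ∷ xs) f g = ≈-trans (+-congˡ (∑-+ xs f g)) (+-interchange (f x) (g x) (∑ xs f) (∑ xs g))

  ∑-*ˡ : ∀ {A : Set} (xs : List A) (k : Carrier) (f : A → Carrier) → k * ∑ xs f ≈ ∑ xs (λ x → k * f x)
  ∑-*ˡ [] k f = zeroʳ k
  ∑-*ˡ (x ∷ xs) k f = ≈-trans (distribˡ k (f x) (∑ xs f)) (+-congˡ (∑-*ˡ xs k f))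

  ∑-*ʳ : ∀ {A : Set} (xs : List A) (k : Carrier) (f : A → Carrier) → ∑ xs f * k ≈ ∑ xs (λ x → f x * k)
  ∑-*ʳ [] k f = zeroˡ k
  ∑-*ʳ (x ∷ xs) k f = ≈-trans (distribʳ k (f x) (∑ xs f)) (+-congˡ (∑-*ʳ xs k f))

  ∑-swap : ∀ {A B : Set} (xs : List A) (ys : List B) (f : A → B → Carrier) →
           ∑ xs (λ x → ∑ ys (f x)) ≈ ∑ ys (λ y → ∑ xs (λ x → f x y))
  ∑-swap [] ys f = ≈-sym (∑-zero ys (λ _ → ≈-refl))
  ∑-swap (x ∷ xs) ys f = ≈-trans (+-congˡ (∑-swap xs ys f)) (≈-sym (∑-+ ys (f x) (λ y → ∑ xs (λ x → f x y))))

  ∑-++ : ∀ {A : Set} (xs ys : List A) (f : A → Carrier) → ∑ (xs List.++ ys) f ≈ ∑ xs f + ∑ ys f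
  ∑-++ [] ys f = ≈-sym (+-identityˡ _)
  ∑-++ (x ∷ xs) ys f = ≈-trans (+-congˡ (∑-++ xs ys f)) (≈-sym (+-assoc _ _ _))

  ∑-map : ∀ {A B : Set} (g : A → B) (xs : List A) (f : B → Carrier) → ∑ (List.map g xs) f ≈ ∑ xs (λ x → f (g x))
  ∑-map g [] f = ≈-refl
  ∑-map g (x ∷ xs) f = +-congˡ (∑-map g xs f)

  ∑-swap² : ∀ {A B C D : Set} (as : List A) (bs : List B) (cs : List C) (ds : List D)
            (f : A → B → C → D → Carrier) →
            ∑ as (λ a → ∑ bs (λ b → ∑ cs (λ c → ∑ ds (f a b c)))) ≈
            ∑ cs (λ c → ∑ ds (λ d → ∑ as (λ a → ∑ bs (λ b → f a b c d))))
  ∑-swap² as bs cs ds f = begin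
    ∑ as (λ a → ∑ bs (λ b → ∑ cs (λ c → ∑ ds (f a b c))))
      ≈⟨ ∑-cong as (λ a → ∑-swap bs cs (λ b c → ∑ ds (f a b c))) ⟩
    ∑ as (λ a → ∑ cs (λ c → ∑ bs (λ b → ∑ ds (f a b c))))
      ≈⟨ ∑-swap as cs (λ a c → ∑ bs (λ b → ∑ ds (f a b c))) ⟩
    ∑ cs (λ c → ∑ as (λ a → ∑ bs (λ b → ∑ ds (f a b c))))
      ≈⟨ ∑-cong cs (λ c → ∑-cong as (λ a → ∑-swap bs ds (λ b → f a b c))) ⟩
    ∑ cs (λ c → ∑ as (λ a → ∑ ds (λ d → ∑ bs (λ b → f a b c d))))
      ≈⟨ ∑-cong cs (λ c → ∑-swap as ds (λ a d → ∑ bs (λ b → f a b c d))) ⟩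
    ∑ cs (λ c → ∑ ds (λ d → ∑ as (λ a → ∑ bs (λ b → f a b c d)))) ∎

  ι-∧ : ∀ a b → ι (a ∧ b) ≈ ι a * ι b
  ι-∧ true b = ≈-sym (*-identityˡ (ι b))
  ι-∧ false b = ≈-sym (zeroˡ (ι b))

  ι-true : ∀ {b} (h : Carrier) → T b → ι b * h ≈ h
  ι-true {true} h _ = *-identityˡ h

  ι-false : ∀ {b} (h : Carrier) → ¬ T b → ι b * h ≈ 0#
  ι-false {true} h f = ⊥-elim (f tt)
  ι-false {false} h _ = zeroˡ h

  ∑-pick : ∀ {A : Set} (xs : List A) (d : A → Bool) (h : A → Carrier) (c : A) → Unique xs → c ∈ xs →
           (∀ x → T (d x) → c ≡ x) → T (d c) → ∑ xs (λ x → ι (d x) * h x) ≈ h c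
  ∑-pick (_ ∷ ys) d h c (c∉ys ∷ _) (here refl) only dc =
    ≈-trans (+-cong (ι-true (h c) dc) (∑-zero∈ ys (λ x x∈ys dx → All.lookup c∉ys x∈ys (only x dx))))
            (+-identityʳ (h c))
    where
    ∑-zero∈ : ∀ ys → (∀ x → x ∈ ys → ¬ T (d x)) → ∑ ys (λ x → ι (d x) * h x) ≈ 0#
    ∑-zero∈ [] _ = ≈-refl
    ∑-zero∈ (y ∷ ys) no-d = ≈-trans (+-cong (ι-false (h y) (no-d y (here refl))) (∑-zero∈ ys (λ x p → no-d x (there p))))
                                    (+-identityˡ 0#)
  ∑-pick (y ∷ ys) d h c (y∉ys ∷ u) (there c∈ys) only dc =
    ≈-trans (+-cong (ι-false (h y) (λ dy → All.lookup y∉ys c∈ys (sym (only y dy)))) (∑-pick ys d h c u c∈ys only dc))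
            (+-identityˡ (h c))

  ∑-pick-guarded : ∀ {A : Set} (xs : List A) (d : A → Bool) (b : Bool) (h : A → Carrier) (c : A) → Unique xs →
                   (T b → c ∈ xs) → (∀ x → T (d x) → c ≡ x) → T (d c) →
                   ∑ xs (λ x → ι (d x) * (ι b * h x)) ≈ ι b * h c
  ∑-pick-guarded xs d true h c u c∈ only dc = ≈-trans (∑-pick xs d (λ x → 1# * h x) c u (c∈ tt) only dc) ≈-refl
  ∑-pick-guarded xs d false h c u c∈ only dc =
    ≈-trans (∑-zero xs λ x → ≈-trans (*-congˡ (zeroˡ (h x))) (zeroʳ _)) (≈-sym (zeroˡ (h c)))

⊆ᵇ-cons : ∀ {k} (c a : Bool) (F E : Subset k) → ((c ∷ F) ⊆ᵇ (a ∷ E)) ≡ (c ⇒ᵇ a) ∧ (F ⊆ᵇ E)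
⊆ᵇ-cons c a F E = bool-ext
  (λ h → ∧-intro {c ⇒ᵇ a} (allF-elim {P = member⇒} h zero) (allF-intro λ x → allF-elim {P = member⇒} h (suc x)))
  (λ h → allF-intro {P = member⇒} λ { zero → ∧-fst {c ⇒ᵇ a} h ; (suc x) → allF-elim (∧-snd {c ⇒ᵇ a} h) x })
  where
  member⇒ : Fin (suc _) → Bool
  member⇒ x = (x ∈ᵇ (c ∷ F)) ⇒ᵇ (x ∈ᵇ (a ∷ E))

module Factorisation {c ℓ} (CR : CommutativeRing c ℓ) where
  open CommutativeRing CR renaming (refl to ≈-refl; sym to ≈-sym; trans to ≈-trans) hiding (zero)
  open Sums CR
  open ≈-Reasoning setoid
  open CMSolver *-commutativeMonoid using (solve; _⊜_; _⊕_)

  W : ∀ {m} (p : Fin m → Carrier) (E F : Subset m) → Carrier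
  W p E F = ι (F ⊆ᵇ E) * Pr CR p E F

  ∑ₛ : ∀ m → (Subset m → Carrier) → Carrier
  ∑ₛ m = ∑ (allSubsets m)

  ∑ₛ-suc : ∀ m (f : Subset (suc m) → Carrier) →
           ∑ₛ (suc m) f ≈ ∑ₛ m (λ F → f (true ∷ F)) + ∑ₛ m (λ F → f (false ∷ F))
  ∑ₛ-suc m f = begin
    ∑ₛ (suc m) f
      ≈⟨ ∑-++ (List.map (true ∷_) A) (List.map (false ∷_) A List.++ []) f ⟩
    ∑ (List.map (true ∷_) A) f + ∑ (List.map (false ∷_) A List.++ []) f
      ≈⟨ +-congˡ (∑-++ (List.map (false ∷_) A) [] f) ⟩
    ∑ (List.map (true ∷_) A) f + (∑ (List.map (false ∷_) A) f + 0#)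
      ≈⟨ +-cong (∑-map (true ∷_) A f) (≈-trans (+-identityʳ _) (∑-map (false ∷_) A f)) ⟩
    ∑ₛ m (λ F → f (true ∷ F)) + ∑ₛ m (λ F → f (false ∷ F)) ∎
    where A = allSubsets m

  ∑ₛ²-*ˡ : ∀ m (k : Carrier) (h : Subset m → Subset m → Carrier) →
           ∑ₛ m (λ F₁ → ∑ₛ m (λ F₂ → k * h F₁ F₂)) ≈ k * ∑ₛ m (λ F₁ → ∑ₛ m (h F₁))
  ∑ₛ²-*ˡ m k h = ≈-trans (∑-cong (allSubsets m) (λ F₁ → ≈-sym (∑-*ˡ (allSubsets m) k (h F₁))))
                         (≈-sym (∑-*ˡ (allSubsets m) k (λ F₁ → ∑ₛ m (h F₁))))

  -- The factor contributed by one edge of probability q: it is allowed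
  -- (a) or not, and present (c) or not.
  edgeWeight : Bool → Bool → Carrier → Carrier
  edgeWeight a c q = ι (c ⇒ᵇ a) * (if a then (if c then q else 1# + (- q)) else 1#)

  W-cons : ∀ {m} (p : Fin (suc m) → Carrier) a E c F →
           W p (a ∷ E) (c ∷ F) ≈ edgeWeight a c (p zero) * W (λ i → p (suc i)) E F
  W-cons p a E c F = begin
    ι ((c ∷ F) ⊆ᵇ (a ∷ E)) * (t * Pr CR (λ i → p (suc i)) E F)
      ≈⟨ *-congʳ (≈-trans (reflexive (cong ι (⊆ᵇ-cons c a F E))) (ι-∧ (c ⇒ᵇ a) (F ⊆ᵇ E))) ⟩
    (ι (c ⇒ᵇ a) * ι (F ⊆ᵇ E)) * (t * Pr CR (λ i → p (suc i)) E F)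
      ≈⟨ solve 4 (λ x y z w → (x ⊕ y) ⊕ (z ⊕ w) ⊜ (x ⊕ z) ⊕ (y ⊕ w)) ≈-refl _ _ _ _ ⟩
    edgeWeight a c (p zero) * W (λ i → p (suc i)) E F ∎
    where t = if a then (if c then p zero else 1# + (- p zero)) else 1#

  -- The head edge belongs to exactly one side; the side it does not belong
  -- to contributes the factor 0 if the edge is chosen and 1 otherwise.
  head-edge : ∀ x y z o D₁ D₀ → z ≈ 0# → o ≈ 1# →
              x * D₁ + y * D₀ ≈ ((x * z) * D₁ + (x * o) * D₁) + ((y * z) * D₁ + (y * o) * D₀)
  head-edge x y z o D₁ D₀ z≈0 o≈1 = ≈-sym (begin
    ((x * z) * D₁ + (x * o) * D₁) + ((y * z) * D₁ + (y * o) * D₀)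
      ≈⟨ +-cong (+-cong (*-congʳ (*0 x)) (*-congʳ (*1 x))) (+-cong (*-congʳ (*0 y)) (*-congʳ (*1 y))) ⟩
    (0# * D₁ + x * D₁) + (0# * D₁ + y * D₀)
      ≈⟨ +-cong (drop0 (x * D₁)) (drop0 (y * D₀)) ⟩
    x * D₁ + y * D₀ ∎)
    where
    *0 : ∀ w → w * z ≈ 0#
    *0 w = ≈-trans (*-congˡ z≈0) (zeroʳ w)
    *1 : ∀ w → w * o ≈ w
    *1 w = ≈-trans (*-congˡ o≈1) (*-identityʳ w)
    drop0 : ∀ w → 0# * D₁ + w ≈ w
    drop0 w = ≈-trans (+-congʳ (zeroˡ D₁)) (+-identityˡ w)

  head-edge′ : ∀ x y z o D₁ D₀ → z ≈ 0# → o ≈ 1# →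
               x * D₁ + y * D₀ ≈ ((z * x) * D₁ + (z * y) * D₁) + ((o * x) * D₁ + (o * y) * D₀)
  head-edge′ x y z o D₁ D₀ z≈0 o≈1 = ≈-sym (begin
    ((z * x) * D₁ + (z * y) * D₁) + ((o * x) * D₁ + (o * y) * D₀)
      ≈⟨ +-cong (+-cong (*-congʳ (0* x)) (*-congʳ (0* y))) (+-cong (*-congʳ (1* x)) (*-congʳ (1* y))) ⟩
    (0# * D₁ + 0# * D₁) + (x * D₁ + y * D₀)
      ≈⟨ +-congʳ (≈-trans (+-cong (zeroˡ D₁) (zeroˡ D₁)) (+-identityˡ 0#)) ⟩
    0# + (x * D₁ + y * D₀)
      ≈⟨ +-identityˡ _ ⟩
    x * D₁ + y * D₀ ∎)
    where
    0* : ∀ w → z * w ≈ 0#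
    0* w = ≈-trans (*-congʳ z≈0) (zeroˡ w)
    1* : ∀ w → o * w ≈ w
    1* w = ≈-trans (*-congʳ o≈1) (*-identityˡ w)

  -- By induction on the number of edges, deciding the first edge: in G it
  -- contributes q or 1 - q, and on the side containing it the same factor.
  factorise : ∀ m (p : Fin m → Carrier) (E₁ E₂ : Subset m) →
              (∀ e → T ((e ∈ᵇ E₁) ∨ (e ∈ᵇ E₂))) → (∀ e → ¬ T ((e ∈ᵇ E₁) ∧ (e ∈ᵇ E₂))) →
              (g : Subset m → Carrier) →
              ∑ₛ m (λ F → W p ⊤ F * g F) ≈ ∑ₛ m (λ F₁ → ∑ₛ m (λ F₂ → g (F₁ ∪ F₂) * (W p E₁ F₁ * W p E₂ F₂)))
  factorise zero p [] [] _ _ g = begin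
    (1# * 1#) * g [] + 0#                    ≈⟨ +-congʳ (*-congʳ (*-identityˡ 1#)) ⟩
    1# * g [] + 0#                           ≈⟨ +-congʳ (*-identityˡ (g [])) ⟩
    g [] + 0#                                ≈⟨ +-congʳ (≈-sym (*-identityʳ (g []))) ⟩
    g [] * 1# + 0#                           ≈⟨ +-congʳ (*-congˡ (≈-sym (*-identityˡ 1#))) ⟩
    g [] * (1# * 1#) + 0#                    ≈⟨ +-congʳ (*-congˡ (≈-sym (*-cong (*-identityˡ 1#) (*-identityˡ 1#)))) ⟩
    g [] * ((1# * 1#) * (1# * 1#)) + 0#      ≈⟨ ≈-sym (+-identityʳ _) ⟩
    (g [] * ((1# * 1#) * (1# * 1#)) + 0#) + 0# ∎
  factorise (suc m) p (a ∷ E₁) (b ∷ E₂) cover disjoint g = begin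
    ∑ₛ (suc m) (λ F → W p ⊤ F * g F)
      ≈⟨ ∑ₛ-suc m _ ⟩
    ∑ₛ m (λ F → W p ⊤ (true ∷ F) * g (true ∷ F)) + ∑ₛ m (λ F → W p ⊤ (false ∷ F) * g (false ∷ F))
      ≈⟨ +-cong (whole true) (whole false) ⟩
    edgeWeight true true q * D true + edgeWeight true false q * D false
      ≈⟨ split-head a b (cover zero) (disjoint zero) ⟩
    (ω true true * D (true ∨ true) + ω true false * D (true ∨ false)) +
    (ω false true * D (false ∨ true) + ω false false * D (false ∨ false))
      ≈⟨ ≈-sym (+-cong (+-cong (parts true true) (parts true false)) (+-cong (parts false true) (parts false false))) ⟩
    (∑ₛ² true true + ∑ₛ² true false) + (∑ₛ² false true + ∑ₛ² false false)
      ≈⟨ ≈-sym (+-cong (∑-+ (allSubsets m) _ _) (∑-+ (allSubsets m) _ _)) ⟩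
    ∑ₛ m (λ F₁ → ∑ₛ m (term (true ∷ F₁) ∘ (true ∷_)) + ∑ₛ m (term (true ∷ F₁) ∘ (false ∷_))) +
    ∑ₛ m (λ F₁ → ∑ₛ m (term (false ∷ F₁) ∘ (true ∷_)) + ∑ₛ m (term (false ∷ F₁) ∘ (false ∷_)))
      ≈⟨ ≈-sym (+-cong (∑-cong (allSubsets m) (λ F₁ → ∑ₛ-suc m (term (true ∷ F₁))))
                       (∑-cong (allSubsets m) (λ F₁ → ∑ₛ-suc m (term (false ∷ F₁))))) ⟩
    ∑ₛ m (λ F₁ → ∑ₛ (suc m) (term (true ∷ F₁))) + ∑ₛ m (λ F₁ → ∑ₛ (suc m) (term (false ∷ F₁)))
      ≈⟨ ≈-sym (∑ₛ-suc m (λ F₁ → ∑ₛ (suc m) (term F₁))) ⟩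
    ∑ₛ (suc m) (λ F₁ → ∑ₛ (suc m) (term F₁)) ∎
    where
    q = p zero
    p' : Fin m → Carrier
    p' i = p (suc i)
    term : Subset (suc m) → Subset (suc m) → Carrier
    term F₁ F₂ = g (F₁ ∪ F₂) * (W p (a ∷ E₁) F₁ * W p (b ∷ E₂) F₂)
    ω : Bool → Bool → Carrier
    ω c₁ c₂ = edgeWeight a c₁ q * edgeWeight b c₂ q
    D : Bool → Carrier
    D c = ∑ₛ m (λ F₁ → ∑ₛ m (λ F₂ → g (c ∷ (F₁ ∪ F₂)) * (W p' E₁ F₁ * W p' E₂ F₂)))
    ∑ₛ² : Bool → Bool → Carrier
    ∑ₛ² c₁ c₂ = ∑ₛ m (λ F₁ → ∑ₛ m (λ F₂ → term (c₁ ∷ F₁) (c₂ ∷ F₂)))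
    whole : ∀ c → ∑ₛ m (λ F → W p ⊤ (c ∷ F) * g (c ∷ F)) ≈ edgeWeight true c q * D c
    whole c = begin
      ∑ₛ m (λ F → W p ⊤ (c ∷ F) * g (c ∷ F))
        ≈⟨ ∑-cong (allSubsets m) (λ F → ≈-trans (*-congʳ (W-cons p true ⊤ c F)) (*-assoc _ _ _)) ⟩
      ∑ₛ m (λ F → edgeWeight true c q * (W p' ⊤ F * g (c ∷ F)))
        ≈⟨ ≈-sym (∑-*ˡ (allSubsets m) _ _) ⟩
      edgeWeight true c q * ∑ₛ m (λ F → W p' ⊤ F * g (c ∷ F))
        ≈⟨ *-congˡ (factorise m p' E₁ E₂ (λ e → cover (suc e)) (λ e → disjoint (suc e)) (λ F → g (c ∷ F))) ⟩
      edgeWeight true c q * D c ∎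
    parts : ∀ c₁ c₂ → ∑ₛ² c₁ c₂ ≈ ω c₁ c₂ * D (c₁ ∨ c₂)
    parts c₁ c₂ = ≈-trans
      (∑-cong (allSubsets m) λ F₁ → ∑-cong (allSubsets m) λ F₂ →
        ≈-trans (*-congˡ (*-cong (W-cons p a E₁ c₁ F₁) (W-cons p b E₂ c₂ F₂)))
                (solve 5 (λ G x y u v → G ⊕ ((x ⊕ u) ⊕ (y ⊕ v)) ⊜ (x ⊕ y) ⊕ (G ⊕ (u ⊕ v))) ≈-refl _ _ _ _ _))
      (∑ₛ²-*ˡ m (ω c₁ c₂) (λ F₁ F₂ → g ((c₁ ∨ c₂) ∷ (F₁ ∪ F₂)) * (W p' E₁ F₁ * W p' E₂ F₂)))
    split-head : ∀ a b → T (a ∨ b) → ¬ T (a ∧ b) →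
      edgeWeight true true q * D true + edgeWeight true false q * D false ≈
      (edgeWeight a true q * edgeWeight b true q * D (true ∨ true) +
       edgeWeight a true q * edgeWeight b false q * D (true ∨ false)) +
      (edgeWeight a false q * edgeWeight b true q * D (false ∨ true) +
       edgeWeight a false q * edgeWeight b false q * D (false ∨ false))
    split-head true true _ both = ⊥-elim (both tt)
    split-head true false _ _ = head-edge _ _ _ _ _ _ (zeroˡ 1#) (*-identityˡ 1#)
    split-head false true _ _ = head-edge′ _ _ _ _ _ _ (zeroˡ 1#) (*-identityˡ 1#)
    split-head false false () _

⊆ᵇ-elim : ∀ {m} (F E : Subset m) → T (F ⊆ᵇ E) → ∀ e → T (e ∈ᵇ F) → T (e ∈ᵇ E)
⊆ᵇ-elim F E h e = ⇒-elim {e ∈ᵇ F} (allF-elim {P = λ x → (x ∈ᵇ F) ⇒ᵇ (x ∈ᵇ E)} h e)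

module Assembly {c ℓ} (CR : CommutativeRing c ℓ) {n m : ℕ} (ends : Ends n m)
  (p : Fin m → CommutativeRing.Carrier CR) (K : Subset n) (S : KSplitting ends K) where
  open CommutativeRing CR renaming (refl to ≈-refl; sym to ≈-sym; trans to ≈-trans) hiding (zero)
  open Sums CR
  open Factorisation CR
  open ≈-Reasoning setoid
  open CMSolver *-commutativeMonoid using (solve; _⊜_; _⊕_)
  open KSplitting S
  open Terminals S

  L : List (LPart n)
  L = ΠLX X K

  g : Subset m → Carrier
  g F = ι (Mᵇ ends F K)

  π₁ π₂ : Subset m → LPart n
  π₁ F₁ = compPart ends F₁ K¹ X
  π₂ F₂ = compPart ends F₂ K² X

  M₁ M₂ : Subset m → Bool
  M₁ F₁ = Contraction.M/X ends X F₁ K¹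
  M₂ F₂ = Contraction.M/X ends X F₂ K²

  m∨ : LPart n → LPart n → Bool
  m∨ π σ = mᵇ (π ∨ᴸ σ)

  a₁ a₂ : Subset m → LPart n → Carrier
  a₁ F₁ π = ι (F₁ ⊆ᵇ E¹) * ((ι (eqLPart (π₁ F₁) π) * ι (M₁ F₁)) * Pr CR p E¹ F₁)
  a₂ F₂ σ = ι (F₂ ⊆ᵇ E²) * ((ι (eqLPart (π₂ F₂) σ) * ι (M₂ F₂)) * Pr CR p E² F₂)

  term : Subset m → Subset m → LPart n → LPart n → Carrier
  term F₁ F₂ π σ = (a₁ F₁ π * ι (m∨ π σ)) * a₂ F₂ σ

  WW : Subset m → Subset m → Carrier
  WW F₁ F₂ = W p E¹ F₁ * W p E² F₂

  Rel-factorised : Rel CR ends p ⊤ K ≈ ∑ₛ m (λ F₁ → ∑ₛ m (λ F₂ → g (F₁ ∪ F₂) * WW F₁ F₂))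
  Rel-factorised = ≈-trans
    (∑-cong (allSubsets m) (λ F → solve 3 (λ a b c → a ⊕ (b ⊕ c) ⊜ (a ⊕ c) ⊕ b) ≈-refl _ _ _))
    (factorise m p E¹ E² (λ e → ≡-to-T (E-cover e)) (λ e both → subst T (E-disjoint e) both) g)

  M-split-weighted : ∀ F₁ F₂ → g (F₁ ∪ F₂) * WW F₁ F₂ ≈ ι (M₁ F₁ ∧ (M₂ F₂ ∧ m∨ (π₁ F₁) (π₂ F₂))) * WW F₁ F₂
  M-split-weighted F₁ F₂ with T? (F₁ ⊆ᵇ E¹) | T? (F₂ ⊆ᵇ E²)
  ... | yes s₁ | yes s₂ =
    *-congʳ (reflexive (cong ι (Splitting.M-splits S F₁ F₂ (⊆ᵇ-elim F₁ E¹ s₁) (⊆ᵇ-elim F₂ E² s₂))))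
  ... | no s₁ | _ = ≈-trans (vanish₁ (g (F₁ ∪ F₂))) (≈-sym (vanish₁ _))
    where
    vanish₁ : ∀ x → x * WW F₁ F₂ ≈ 0#
    vanish₁ x = ≈-trans (*-congˡ (≈-trans (*-congʳ (ι-false _ s₁)) (zeroˡ _))) (zeroʳ x)
  ... | yes _ | no s₂ = ≈-trans (vanish₂ (g (F₁ ∪ F₂))) (≈-sym (vanish₂ _))
    where
    vanish₂ : ∀ x → x * WW F₁ F₂ ≈ 0#
    vanish₂ x = ≈-trans (*-congˡ (≈-trans (*-congˡ (ι-false _ s₂)) (zeroʳ _))) (zeroʳ x)

  π₁∈L : ∀ F₁ → T (M₁ F₁) → π₁ F₁ ∈ L
  π₁∈L F₁ h = CompPartMember.member ends F₁ K¹ X K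
    (λ x xX xK → ∩-intro K V¹ x xK (proj₁ (∩-elim V¹ V² x xX)))
    (let (x , xX , c) = Contraction.M/X-elim ends X F₁ K¹ h k₁ k₁∈K¹ in x , xX , k₁ , k₁∈K¹ , c)

  π₂∈L : ∀ F₂ → T (M₂ F₂) → π₂ F₂ ∈ L
  π₂∈L F₂ h = CompPartMember.member ends F₂ K² X K
    (λ x xX xK → ∩-intro K V² x xK (proj₂ (∩-elim V¹ V² x xX)))
    (let (x , xX , c) = Contraction.M/X-elim ends X F₂ K² h k₂ k₂∈K² in x , xX , k₂ , k₂∈K² , c)

  -- Step 3: for fixed F₁, F₂ only π = π₁(F₁), σ = π₂(F₂) contribute to the
  -- double sum over Π_l(X, π_X), and that term is M(H,K) Pr(F₁) Pr(F₂).
  term-sum : ∀ F₁ F₂ → ∑ L (λ π → ∑ L (term F₁ F₂ π)) ≈ g (F₁ ∪ F₂) * WW F₁ F₂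
  term-sum F₁ F₂ = begin
    ∑ L (λ π → ∑ L (term F₁ F₂ π))
      ≈⟨ ∑-cong L (λ π → ∑-cong L (λ σ → regroup π σ)) ⟩
    ∑ L (λ π → ∑ L (λ σ → d₁ π * (ι (M₁ F₁) * (d₂ σ * (ι (M₂ F₂) * H π σ)))))
      ≈⟨ ∑-cong L (λ π → ≈-sym (≈-trans (*-congˡ (∑-*ˡ L (ι (M₁ F₁)) _)) (∑-*ˡ L (d₁ π) _))) ⟩
    ∑ L (λ π → d₁ π * (ι (M₁ F₁) * ∑ L (λ σ → d₂ σ * (ι (M₂ F₂) * H π σ))))
      ≈⟨ ∑-cong L (λ π → *-congˡ (*-congˡ (∑-pick-guarded L (eqLPart (π₂ F₂)) (M₂ F₂) (H π) (π₂ F₂)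
                                          (ΠLX-unique X K) (π₂∈L F₂) (eqLPart-elim _) (eqLPart-refl (π₂ F₂))))) ⟩
    ∑ L (λ π → d₁ π * (ι (M₁ F₁) * (ι (M₂ F₂) * H π (π₂ F₂))))
      ≈⟨ ∑-pick-guarded L (eqLPart (π₁ F₁)) (M₁ F₁) (λ π → ι (M₂ F₂) * H π (π₂ F₂)) (π₁ F₁)
                        (ΠLX-unique X K) (π₁∈L F₁) (eqLPart-elim _) (eqLPart-refl (π₁ F₁)) ⟩
    ι (M₁ F₁) * (ι (M₂ F₂) * (ι (m∨ (π₁ F₁) (π₂ F₂)) * WW F₁ F₂))
      ≈⟨ ≈-sym (≈-trans (*-congʳ (≈-trans (ι-∧ _ _) (*-congˡ (ι-∧ _ _))))
                        (≈-trans (*-assoc _ _ _) (*-congˡ (*-assoc _ _ _)))) ⟩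
    ι (M₁ F₁ ∧ (M₂ F₂ ∧ m∨ (π₁ F₁) (π₂ F₂))) * WW F₁ F₂
      ≈⟨ ≈-sym (M-split-weighted F₁ F₂) ⟩
    g (F₁ ∪ F₂) * WW F₁ F₂ ∎
    where
    d₁ d₂ : LPart n → Carrier
    d₁ π = ι (eqLPart (π₁ F₁) π)
    d₂ σ = ι (eqLPart (π₂ F₂) σ)
    H : LPart n → LPart n → Carrier
    H π σ = ι (m∨ π σ) * WW F₁ F₂
    regroup : ∀ π σ → term F₁ F₂ π σ ≈ d₁ π * (ι (M₁ F₁) * (d₂ σ * (ι (M₂ F₂) * H π σ)))
    regroup π σ = solve 9 (λ s₁ e₁ b₁ P₁ μ s₂ e₂ b₂ P₂ →
      ((s₁ ⊕ ((e₁ ⊕ b₁) ⊕ P₁)) ⊕ μ) ⊕ (s₂ ⊕ ((e₂ ⊕ b₂) ⊕ P₂)) ⊜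
      e₁ ⊕ (b₁ ⊕ (e₂ ⊕ (b₂ ⊕ (μ ⊕ ((s₁ ⊕ P₁) ⊕ (s₂ ⊕ P₂))))))) ≈-refl _ _ _ _ _ _ _ _ _

  bilinear-expanded : bilinear CR ends p K S ≈ ∑ L (λ π → ∑ L (λ σ → ∑ₛ m (λ F₁ → ∑ₛ m (λ F₂ → term F₁ F₂ π σ))))
  bilinear-expanded = ∑-cong L λ π → ∑-cong L λ σ → begin
    (∑ₛ m (λ F₁ → a₁ F₁ π) * ι (m∨ π σ)) * ∑ₛ m (λ F₂ → a₂ F₂ σ)
      ≈⟨ *-congʳ (∑-*ʳ (allSubsets m) (ι (m∨ π σ)) (λ F₁ → a₁ F₁ π)) ⟩
    ∑ₛ m (λ F₁ → a₁ F₁ π * ι (m∨ π σ)) * ∑ₛ m (λ F₂ → a₂ F₂ σ)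
      ≈⟨ ∑-*ʳ (allSubsets m) _ _ ⟩
    ∑ₛ m (λ F₁ → (a₁ F₁ π * ι (m∨ π σ)) * ∑ₛ m (λ F₂ → a₂ F₂ σ))
      ≈⟨ ∑-cong (allSubsets m) (λ F₁ → ∑-*ˡ (allSubsets m) _ _) ⟩
    ∑ₛ m (λ F₁ → ∑ₛ m (λ F₂ → term F₁ F₂ π σ)) ∎

-- Theorem 5.17.
theorem5p17 : ∀ {c ℓ} (CR : CommutativeRing c ℓ) (n m : ℕ)
    (ends : Fin m → Fin n × Fin n)
    → (∀ e → proj₁ (ends e) ≢ proj₂ (ends e))
    → (p : Fin m → CommutativeRing.Carrier CR)
    → (K : Subset n) → 2 ≤ ∣ K ∣
    → (S : KSplitting ends K)
    → CommutativeRing._≈_ CR (Rel CR ends p ⊤ K) (bilinear CR ends p K S)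
theorem5p17 CR n m ends _ p K _ S = begin
  Rel CR ends p ⊤ K
    ≈⟨ Rel-factorised ⟩
  ∑ₛ m (λ F₁ → ∑ₛ m (λ F₂ → g (F₁ ∪ F₂) * WW F₁ F₂))
    ≈⟨ ∑-cong (allSubsets m) (λ F₁ → ∑-cong (allSubsets m) (λ F₂ → ≈-sym (term-sum F₁ F₂))) ⟩
  ∑ₛ m (λ F₁ → ∑ₛ m (λ F₂ → ∑ L (λ π → ∑ L (term F₁ F₂ π))))
    ≈⟨ ∑-swap² (allSubsets m) (allSubsets m) L L (λ F₁ F₂ π σ → term F₁ F₂ π σ) ⟩
  ∑ L (λ π → ∑ L (λ σ → ∑ₛ m (λ F₁ → ∑ₛ m (λ F₂ → term F₁ F₂ π σ))))
    ≈⟨ ≈-sym bilinear-expanded ⟩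
  bilinear CR ends p K S ∎
  where
  open CommutativeRing CR using (_*_; setoid) renaming (sym to ≈-sym)
  open ≈-Reasoning setoid
  open Sums CR using (∑; ∑-cong; ∑-swap²)
  open Factorisation CR using (∑ₛ)
  open Assembly CR ends p K S using (L; g; WW; term; Rel-factorised; term-sum; bilinear-expanded)
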